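{- Let $n\geqslant 4$ be an integer and let $A=\{a_1<\dots<a_n\}$, $B=\{b_1<\dots<b_n\}$ be linearly ordered sets. There are exactly eight ordered bipartite graphs with parts $A$ and $B$ that are perfect matchings (i.e., $1$-regular, with $n$ edges) and do not contain $K_{2,2}$ as an interval minor. These eight graphs form exactly three equivalence classes.
   Context: All graphs are simple. An ordered bipartite graph $(G;A,B)$ is a bipartite graph $G$ whose vertex set is partitioned into independent sets $A$ and $B$, each equipped with a linear order. Two vertices $u<v$ of the same part are consecutive if no vertex $w$ of that part satisfies $u<w<v$. Identifying two consecutive vertices $u,v$ replaces them by a single vertex $w$ (in their place in the order) whose neighbourhood is the union of the neighbourhoods of $u$ and $v$. Two ordered bipartite graphs are isomorphic if there is a graph isomorphism between them that maps parts to parts (possibly exchanging the two parts) and preserves both linear orders. $H$ is an interval minor of $G$ if a graph isomorphic to $H$ can be obtained from $G$ by repeatedly deleting edges and identifying consecutive vertices. Two ordered bipartite graphs $G,G'$ are equivalent if $G'$ is isomorphic to a graph obtained from $G$ by reversing the order in one or both parts and possibly exchanging the two parts. A matching of size $n$ is a $1$-regular bipartite graph on $2n$ vertices. -}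

module Defs where

open import Data.Nat using (ℕ; zero; suc)
open import Data.Bool using (Bool; true; false; _∨_)
open import Data.Fin using (Fin; zero; suc; _<_)
open import Data.Vec using (Vec; []; _∷_; lookup; map; zipWith; reverse; transpose; _[_]%=_; _[_]≔_; replicate)
open import Data.Product using (Σ; _×_; _,_; ∃)
open import Data.Sum using (_⊎_)
open import Relation.Binary.PropositionalEquality using (_≡_)

-- An ordered bipartite graph with parts A = {a_0 < ... < a_{p-1}} and
-- B = {b_0 < ... < b_{q-1}} (orders are those of Fin), given by its
-- biadjacency matrix: row i = a_i, column j = b_j.
Mat : ℕ → ℕ → Set
Mat p q = Vec (Vec Bool q) p

adj : ∀ {p q} → Mat p q → Fin p → Fin q → Bool
adj M i j = lookup (lookup M i) j

mergeV : ∀ {A : Set} {n} → (A → A → A) → Fin (suc n) → Vec A (suc (suc n)) → Vec A (suc n)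
mergeV f zero (x ∷ y ∷ xs) = f x y ∷ xs
mergeV {n = suc n} f (suc i) (x ∷ xs) = x ∷ mergeV f i xs

identifyA : ∀ {p q} → Fin (suc p) → Mat (suc (suc p)) q → Mat (suc p) q
identifyA i M = mergeV (zipWith _∨_) i M

identifyB : ∀ {p q} → Fin (suc q) → Mat p (suc (suc q)) → Mat p (suc q)
identifyB j M = map (mergeV _∨_ j) M

deleteEdge : ∀ {p q} → Fin p → Fin q → Mat p q → Mat p q
deleteEdge i j M = M [ i ]%= (λ row → row [ j ]≔ false)

data Step : ∀ {p q p' q'} → Mat p q → Mat p' q' → Set where
  del : ∀ {p q} (M : Mat p q) (i : Fin p) (j : Fin q) →
        adj M i j ≡ true → Step M (deleteEdge i j M)
  idA : ∀ {p q} (M : Mat (suc (suc p)) q) (i : Fin (suc p)) → Step M (identifyA i M)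
  idB : ∀ {p q} (M : Mat p (suc (suc q))) (j : Fin (suc q)) → Step M (identifyB j M)

data Steps : ∀ {p q p' q'} → Mat p q → Mat p' q' → Set where
  done : ∀ {p q} (M : Mat p q) → Steps M M
  step : ∀ {p q p' q' p'' q''} {M : Mat p q} {M' : Mat p' q'} {M'' : Mat p'' q''} →
         Step M M' → Steps M' M'' → Steps M M''

record OrdIso (m m' : ℕ) : Set where
  field
    to       : Fin m → Fin m'
    from     : Fin m' → Fin m
    to-from  : ∀ y → to (from y) ≡ y
    from-to  : ∀ x → from (to x) ≡ x
    mono     : ∀ x y → x < y → to x < to y

Iso : ∀ {p q p' q'} → Mat p q → Mat p' q' → Set
Iso {p} {q} {p'} {q'} G H =
  (Σ (OrdIso p p') λ f → Σ (OrdIso q q') λ g →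
     ∀ i j → adj G i j ≡ adj H (OrdIso.to f i) (OrdIso.to g j))
  ⊎
  (Σ (OrdIso p q') λ f → Σ (OrdIso q p') λ g →
     ∀ i j → adj G i j ≡ adj H (OrdIso.to g j) (OrdIso.to f i))

_≼_ : ∀ {p q p' q'} → Mat p q → Mat p' q' → Set
_≼_ {p' = p'} {q' = q'} H G =
  Σ ℕ λ r → Σ ℕ λ s → Σ (Mat r s) λ G' → Steps G G' × Iso G' H

K22 : Mat 2 2
K22 = replicate 2 (replicate 2 true)

OneRegular : ∀ {p q} → Mat p q → Set
OneRegular {p} {q} M =
  (∀ i → Σ (Fin q) λ j → adj M i j ≡ true × (∀ j' → adj M i j' ≡ true → j' ≡ j)) ×
  (∀ j → Σ (Fin p) λ i → adj M i j ≡ true × (∀ i' → adj M i' j ≡ true → i' ≡ i))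

revAIf : ∀ {p q} → Bool → Mat p q → Mat p q
revAIf true M = reverse M
revAIf false M = M

revBIf : ∀ {p q} → Bool → Mat p q → Mat p q
revBIf true M = map reverse M
revBIf false M = M

Equivalent : ∀ {p q p' q'} → Mat p q → Mat p' q' → Set
Equivalent G G' =
  Σ Bool λ a → Σ Bool λ b →
    Iso G' (revBIf b (revAIf a G)) ⊎ Iso G' (transpose (revBIf b (revAIf a G)))

-- K22 is an interval minor of G exactly when G has edges a₁b₁, a₂b₂, a₃b₃, a₄b₄ with a₁, a₂ < a₃, a₄ and
-- b₁, b₃ < b₂, b₄: deleting edges and identifying consecutive vertices never create such a pattern, and a
-- pattern survives suitable identifications down to a 2 × 2 graph. For a perfect matching σ this means that for all
-- a < b < c < d, σ maps both of a, b below both of c, d or both above. Up to reversing B, such a σ is then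
-- increasing except possibly on the first two and on the last two vertices, and counting the vertices below and
-- above each middle vertex pins it down to the identity with the first and/or last two vertices swapped: 2³
-- matchings. Reversals relate them in three classes, told apart by the number of edges between extreme
-- vertices, which is 2, 1 or 0 and invariant under reversals, transposition and isomorphism.

module Submission where

open import Data.Bool using (Bool; true; false; _∨_)
open import Data.Bool.Properties using (T-≡; ¬-not; ∨-zeroʳ)
open import Data.Empty using (⊥; ⊥-elim)
open import Data.Fin using (Fin; zero; suc; toℕ; fromℕ; fromℕ<; inject₁; opposite)
open import Data.Fin.Properties using (toℕ-injective; toℕ<n; toℕ≤pred[n]; toℕ-fromℕ; toℕ-fromℕ<; fromℕ<-toℕ; opposite-prop; opposite-involutive; pigeonhole)
open import Data.Nat using (ℕ; zero; suc; _+_; _∸_; _<_; _≤_; _≡ᵇ_; _≟_; _<?_; _≤?_; z≤n; s≤s; z<s; s<s)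
open import Data.Nat.Properties
open import Algebra.Properties.CommutativeSemigroup +-commutativeSemigroup using (interchange)
open import Data.Product using (Σ; _×_; _,_; proj₁; proj₂)
open import Data.Sum using (_⊎_; inj₁; inj₂) renaming (map to ⊎-map)
open import Data.Vec using (Vec; []; _∷_; _∷ʳ_; lookup; map; reverse; transpose; replicate; tabulate; updateAt; zipWith; _⊛_)
open import Data.Vec.Properties using (lookup-map; lookup-zipWith; lookup∘tabulate; tabulate∘lookup; tabulate-cong; reverse-∷; lookup-⊛; lookup-replicate)
open import Defs
open import Function using (_∘_)
open import Function.Bundles using (_⇔_; mk⇔; Equivalence)
open import Relation.Binary.Definitions using (Tri; tri<; tri≈; tri>)
open import Relation.Binary.PropositionalEquality
open import Relation.Nullary using (¬_; yes; no)

-- K22 as an interval minor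

Below : ℕ → ℕ → ℕ → ℕ → Set
Below a b c d = a < c × a < d × b < c × b < d

Reflects< : ∀ {m n} → (Fin m → Fin n) → Set
Reflects< f = ∀ x y → toℕ (f x) < toℕ (f y) → toℕ x < toℕ y

Below-reflect : ∀ {m n} {f : Fin m → Fin n} → Reflects< f → ∀ {x₁ x₂ x₃ x₄} →
  Below (toℕ (f x₁)) (toℕ (f x₂)) (toℕ (f x₃)) (toℕ (f x₄)) → Below (toℕ x₁) (toℕ x₂) (toℕ x₃) (toℕ x₄)
Below-reflect r (p₁₃ , p₁₄ , p₂₃ , p₂₄) = r _ _ p₁₃ , r _ _ p₁₄ , r _ _ p₂₃ , r _ _ p₂₄

OrdIso-refl : ∀ n → OrdIso n n
OrdIso-refl n = record
  { to = λ x → x ; from = λ x → x ; to-from = λ _ → refl ; from-to = λ _ → refl ; mono = λ _ _ x<y → x<y }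

OrdIso-from-mono : ∀ {m n} (f : OrdIso m n) x y → toℕ x < toℕ y →
  toℕ (OrdIso.from f x) < toℕ (OrdIso.from f y)
OrdIso-from-mono f x y x<y with <-cmp (toℕ (OrdIso.from f x)) (toℕ (OrdIso.from f y))
... | tri< fx<fy _ _ = fx<fy
... | tri≈ _ fx≡fy _ = ⊥-elim (<-irrefl (cong toℕ x≡y) x<y)
  where
  x≡y : x ≡ y
  x≡y = trans (sym (OrdIso.to-from f x))
          (trans (cong (OrdIso.to f) (toℕ-injective fx≡fy)) (OrdIso.to-from f y))
... | tri> _ _ fy<fx = ⊥-elim (<⇒≱ x<y (<⇒≤ (subst₂ (λ u v → toℕ u < toℕ v)
        (OrdIso.to-from f y) (OrdIso.to-from f x) (OrdIso.mono f _ _ fy<fx))))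

-- Identifying the vertices at positions t and t+1 moves the vertex at position x to mergeIndex t x.
mergeIndex : ∀ {p} → Fin (suc p) → Fin (suc (suc p)) → Fin (suc p)
mergeIndex zero zero = zero
mergeIndex zero (suc x) = x
mergeIndex {suc p} (suc t) zero = zero
mergeIndex {suc p} (suc t) (suc x) = suc (mergeIndex t x)

mergeIndex-mono-≤ : ∀ {p} (t : Fin (suc p)) x y → toℕ x ≤ toℕ y → toℕ (mergeIndex t x) ≤ toℕ (mergeIndex t y)
mergeIndex-mono-≤ zero zero y _ = z≤n
mergeIndex-mono-≤ zero (suc x) (suc y) (s≤s x≤y) = x≤y
mergeIndex-mono-≤ {suc p} (suc t) zero y _ = z≤n
mergeIndex-mono-≤ {suc p} (suc t) (suc x) (suc y) (s≤s x≤y) = s≤s (mergeIndex-mono-≤ t x y x≤y)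

mergeIndex-reflects-< : ∀ {p} (t : Fin (suc p)) → Reflects< (mergeIndex t)
mergeIndex-reflects-< t x y lt = ≰⇒> (λ y≤x → <⇒≱ lt (mergeIndex-mono-≤ t y x y≤x))

Unmerged : ∀ {p} → Fin (suc p) → Fin (suc (suc p)) → Fin (suc (suc p)) → Set
Unmerged t x y = ¬ (toℕ x ≡ toℕ t × toℕ y ≡ suc (toℕ t))

mergeIndex-mono-< : ∀ {p} (t : Fin (suc p)) x y → toℕ x < toℕ y → Unmerged t x y →
  toℕ (mergeIndex t x) < toℕ (mergeIndex t y)
mergeIndex-mono-< zero zero zero () _
mergeIndex-mono-< zero zero (suc zero) _ unmerged = ⊥-elim (unmerged (refl , refl))
mergeIndex-mono-< zero zero (suc (suc y)) _ _ = z<s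
mergeIndex-mono-< zero (suc x) zero () _
mergeIndex-mono-< zero (suc x) (suc y) (s<s x<y) _ = x<y
mergeIndex-mono-< {suc p} (suc t) zero zero () _
mergeIndex-mono-< {suc p} (suc t) zero (suc y) _ _ = z<s
mergeIndex-mono-< {suc p} (suc t) (suc x) zero () _
mergeIndex-mono-< {suc p} (suc t) (suc x) (suc y) (s<s x<y) unmerged =
  s<s (mergeIndex-mono-< t x y x<y (λ (x≡t , y≡t+1) → unmerged (cong suc x≡t , cong suc y≡t+1)))

mergeIndex-Below : ∀ {p} (t : Fin (suc p)) {x₁ x₂ x₃ x₄} → Below (toℕ x₁) (toℕ x₂) (toℕ x₃) (toℕ x₄) →
  Unmerged t x₁ x₃ → Unmerged t x₁ x₄ → Unmerged t x₂ x₃ → Unmerged t x₂ x₄ →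
  Below (toℕ (mergeIndex t x₁)) (toℕ (mergeIndex t x₂)) (toℕ (mergeIndex t x₃)) (toℕ (mergeIndex t x₄))
mergeIndex-Below t (p₁₃ , p₁₄ , p₂₃ , p₂₄) u₁₃ u₁₄ u₂₃ u₂₄ =
  mergeIndex-mono-< t _ _ p₁₃ u₁₃ , mergeIndex-mono-< t _ _ p₁₄ u₁₄ ,
  mergeIndex-mono-< t _ _ p₂₃ u₂₃ , mergeIndex-mono-< t _ _ p₂₄ u₂₄

below-one-unmerged : ∀ {p} {x y z : Fin (suc (suc (suc p)))} → toℕ x < toℕ y → toℕ y ≡ 1 →
  Unmerged (suc zero) x z
below-one-unmerged x<y y≡1 (x≡1 , _) = <-irrefl refl (subst₂ _<_ x≡1 y≡1 x<y)

-- Merge positions 0, 1 unless an upper vertex sits at 1; then both lower ones sit at 0 and merging 1, 2 is safe.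
mergeIndex-keeps-Below : ∀ {p} {x₁ x₂ x₃ x₄ : Fin (suc (suc (suc p)))} →
  Below (toℕ x₁) (toℕ x₂) (toℕ x₃) (toℕ x₄) →
  Σ (Fin (suc (suc p))) λ t →
    Below (toℕ (mergeIndex t x₁)) (toℕ (mergeIndex t x₂)) (toℕ (mergeIndex t x₃)) (toℕ (mergeIndex t x₄))
mergeIndex-keeps-Below {x₁ = x₁} {x₂} {x₃} {x₄} below@(p₁₃ , p₁₄ , p₂₃ , p₂₄)
  with toℕ x₃ ≟ 1 | toℕ x₄ ≟ 1
... | no x₃≢1 | no x₄≢1 =
  zero , mergeIndex-Below zero below (x₃≢1 ∘ proj₂) (x₄≢1 ∘ proj₂) (x₃≢1 ∘ proj₂) (x₄≢1 ∘ proj₂)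
... | yes x₃≡1 | _ = suc zero , mergeIndex-Below (suc zero) below
  (below-one-unmerged p₁₃ x₃≡1) (below-one-unmerged p₁₃ x₃≡1)
  (below-one-unmerged p₂₃ x₃≡1) (below-one-unmerged p₂₃ x₃≡1)
... | no _ | yes x₄≡1 = suc zero , mergeIndex-Below (suc zero) below
  (below-one-unmerged p₁₄ x₄≡1) (below-one-unmerged p₁₄ x₄≡1)
  (below-one-unmerged p₂₄ x₄≡1) (below-one-unmerged p₂₄ x₄≡1)

lookup-mergeV⁺ : ∀ {A : Set} {n} (f : A → A → A) (P : A → Set) →
  (∀ a b → P a → P (f a b)) → (∀ a b → P b → P (f a b)) →
  (t : Fin (suc n)) (V : Vec A (suc (suc n))) (x : Fin (suc (suc n))) →
  P (lookup V x) → P (lookup (mergeV f t V) (mergeIndex t x))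
lookup-mergeV⁺ f P left right zero (a ∷ b ∷ V) zero Pa = left a b Pa
lookup-mergeV⁺ f P left right zero (a ∷ b ∷ V) (suc zero) Pb = right a b Pb
lookup-mergeV⁺ f P left right zero (a ∷ b ∷ V) (suc (suc x)) Px = Px
lookup-mergeV⁺ {n = suc n} f P left right (suc t) (a ∷ V) zero Pa = Pa
lookup-mergeV⁺ {n = suc n} f P left right (suc t) (a ∷ V) (suc x) Px = lookup-mergeV⁺ f P left right t V x Px

lookup-mergeV⁻ : ∀ {A : Set} {n} (f : A → A → A) (P : A → Set) →
  (∀ a b → P (f a b) → P a ⊎ P b) →
  (t : Fin (suc n)) (V : Vec A (suc (suc n))) (y : Fin (suc n)) →
  P (lookup (mergeV f t V) y) → Σ (Fin (suc (suc n))) λ x → mergeIndex t x ≡ y × P (lookup V x)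
lookup-mergeV⁻ f P split zero (a ∷ b ∷ V) zero Pab with split a b Pab
... | inj₁ Pa = zero , refl , Pa
... | inj₂ Pb = suc zero , refl , Pb
lookup-mergeV⁻ f P split zero (a ∷ b ∷ V) (suc y) Py = suc (suc y) , refl , Py
lookup-mergeV⁻ {n = suc n} f P split (suc t) (a ∷ V) zero Pa = zero , refl , Pa
lookup-mergeV⁻ {n = suc n} f P split (suc t) (a ∷ V) (suc y) Py with lookup-mergeV⁻ f P split t V y Py
... | x , refl , Px = suc x , refl , Px

lookup-updateAt-reflects : ∀ {A : Set} {n} (P : A → Set) {f : A → A} → (∀ a → P (f a) → P a) →
  (xs : Vec A n) (i k : Fin n) → P (lookup (updateAt xs i f) k) → P (lookup xs k)
lookup-updateAt-reflects P reflects (x ∷ xs) zero zero Pfx = reflects x Pfx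
lookup-updateAt-reflects P reflects (x ∷ xs) zero (suc k) Pxk = Pxk
lookup-updateAt-reflects P reflects (x ∷ xs) (suc i) zero Px = Px
lookup-updateAt-reflects P reflects (x ∷ xs) (suc i) (suc k) Pxk =
  lookup-updateAt-reflects P reflects xs i k Pxk

∨-trueˡ : ∀ {a} b → a ≡ true → a ∨ b ≡ true
∨-trueˡ b refl = refl

∨-trueʳ : ∀ a {b} → b ≡ true → a ∨ b ≡ true
∨-trueʳ a refl = ∨-zeroʳ a

∨-true⁻ : ∀ a b → a ∨ b ≡ true → a ≡ true ⊎ b ≡ true
∨-true⁻ true b _ = inj₁ refl
∨-true⁻ false b b≡true = inj₂ b≡true

identifyA-edge⁺ : ∀ {p q} (t : Fin (suc p)) (M : Mat (suc (suc p)) q) x c →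
  adj M x c ≡ true → adj (identifyA t M) (mergeIndex t x) c ≡ true
identifyA-edge⁺ t M x c = lookup-mergeV⁺ (zipWith _∨_) (λ row → lookup row c ≡ true)
  (λ a b e → trans (lookup-zipWith _∨_ c a b) (∨-trueˡ _ e))
  (λ a b e → trans (lookup-zipWith _∨_ c a b) (∨-trueʳ _ e)) t M x

identifyA-edge⁻ : ∀ {p q} (t : Fin (suc p)) (M : Mat (suc (suc p)) q) y c →
  adj (identifyA t M) y c ≡ true → Σ (Fin (suc (suc p))) λ x → mergeIndex t x ≡ y × adj M x c ≡ true
identifyA-edge⁻ t M y c = lookup-mergeV⁻ (zipWith _∨_) (λ row → lookup row c ≡ true)
  (λ a b e → ∨-true⁻ _ _ (trans (sym (lookup-zipWith _∨_ c a b)) e)) t M y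

identifyB-edge⁺ : ∀ {p q} (t : Fin (suc q)) (M : Mat p (suc (suc q))) r x →
  adj M r x ≡ true → adj (identifyB t M) r (mergeIndex t x) ≡ true
identifyB-edge⁺ t M r x e = trans (cong (λ row → lookup row (mergeIndex t x)) (lookup-map r (mergeV _∨_ t) M))
  (lookup-mergeV⁺ _∨_ (_≡ true) (λ _ → ∨-trueˡ) (λ a _ → ∨-trueʳ a) t (lookup M r) x e)

identifyB-edge⁻ : ∀ {p q} (t : Fin (suc q)) (M : Mat p (suc (suc q))) r y →
  adj (identifyB t M) r y ≡ true → Σ (Fin (suc (suc q))) λ x → mergeIndex t x ≡ y × adj M r x ≡ true
identifyB-edge⁻ t M r y e = lookup-mergeV⁻ _∨_ (_≡ true) ∨-true⁻ t (lookup M r) y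
  (trans (sym (cong (λ row → lookup row y) (lookup-map r (mergeV _∨_ t) M))) e)

deleteEdge-edge⁻ : ∀ {p q} (i : Fin p) (j : Fin q) (M : Mat p q) r c →
  adj (deleteEdge i j M) r c ≡ true → adj M r c ≡ true
deleteEdge-edge⁻ i j M r c = lookup-updateAt-reflects (λ row → lookup row c ≡ true)
  (λ row → lookup-updateAt-reflects (_≡ true) (λ _ ()) row j c) M i r

-- Edges a₁b₁, a₂b₂, a₃b₃, a₄b₄ in the four blocks of a partition of A and of B into two intervals each.
record K22Pattern {p q} (G : Mat p q) : Set where
  constructor k22Pattern
  field
    {a₁ a₂ a₃ a₄} : Fin p
    {b₁ b₂ b₃ b₄} : Fin q
    rows : Below (toℕ a₁) (toℕ a₂) (toℕ a₃) (toℕ a₄)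
    cols : Below (toℕ b₁) (toℕ b₃) (toℕ b₂) (toℕ b₄)
    edge₁ : adj G a₁ b₁ ≡ true
    edge₂ : adj G a₂ b₂ ≡ true
    edge₃ : adj G a₃ b₃ ≡ true
    edge₄ : adj G a₄ b₄ ≡ true

K22Pattern-reflect : ∀ {p q p' q'} {G : Mat p q} {H : Mat p' q'} {f : Fin p → Fin p'} {g : Fin q → Fin q'} →
  Reflects< f → Reflects< g →
  (∀ r c → adj H r c ≡ true → Σ (Fin p) λ x → Σ (Fin q) λ y → f x ≡ r × g y ≡ c × adj G x y ≡ true) →
  K22Pattern H → K22Pattern G
K22Pattern-reflect rf rg lift (k22Pattern {a₁} {a₂} {a₃} {a₄} {b₁} {b₂} {b₃} {b₄} rows cols e₁ e₂ e₃ e₄)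
  with lift a₁ b₁ e₁ | lift a₂ b₂ e₂ | lift a₃ b₃ e₃ | lift a₄ b₄ e₄
... | _ , _ , refl , refl , e₁' | _ , _ , refl , refl , e₂' | _ , _ , refl , refl , e₃' | _ , _ , refl , refl , e₄' =
  k22Pattern (Below-reflect rf rows) (Below-reflect rg cols) e₁' e₂' e₃' e₄'

Step-reflects-K22Pattern : ∀ {p q p' q'} {M : Mat p q} {M' : Mat p' q'} → Step M M' → K22Pattern M' → K22Pattern M
Step-reflects-K22Pattern (del M i j _) = K22Pattern-reflect (λ _ _ lt → lt) (λ _ _ lt → lt)
  (λ r c e → r , c , refl , refl , deleteEdge-edge⁻ i j M r c e)
Step-reflects-K22Pattern (idA M t) = K22Pattern-reflect (mergeIndex-reflects-< t) (λ _ _ lt → lt)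
  (λ r c e → let x , x↦r , e' = identifyA-edge⁻ t M r c e in x , c , x↦r , refl , e')
Step-reflects-K22Pattern (idB M t) = K22Pattern-reflect (λ _ _ lt → lt) (mergeIndex-reflects-< t)
  (λ r c e → let y , y↦c , e' = identifyB-edge⁻ t M r c e in r , y , refl , y↦c , e')

Steps-reflect-K22Pattern : ∀ {p q p' q'} {M : Mat p q} {M' : Mat p' q'} → Steps M M' → K22Pattern M' → K22Pattern M
Steps-reflect-K22Pattern (done _) = λ pat → pat
Steps-reflect-K22Pattern (step s ss) = Step-reflects-K22Pattern s ∘ Steps-reflect-K22Pattern ss

K22-complete : ∀ a b → adj K22 a b ≡ true
K22-complete zero zero = refl
K22-complete zero (suc zero) = refl
K22-complete (suc zero) zero = refl
K22-complete (suc zero) (suc zero) = refl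

complete-K22Pattern : ∀ {r s} {G : Mat r s} → OrdIso r 2 → OrdIso s 2 → (∀ i j → adj G i j ≡ true) → K22Pattern G
complete-K22Pattern f g complete =
  k22Pattern (f01 , f01 , f01 , f01) (g01 , g01 , g01 , g01) (complete _ _) (complete _ _) (complete _ _) (complete _ _)
  where
  f01 = OrdIso-from-mono f zero (suc zero) z<s
  g01 = OrdIso-from-mono g zero (suc zero) z<s

Iso-K22⇒K22Pattern : ∀ {r s} {G : Mat r s} → Iso G K22 → K22Pattern G
Iso-K22⇒K22Pattern (inj₁ (f , g , adj≡)) =
  complete-K22Pattern f g (λ i j → trans (adj≡ i j) (K22-complete (OrdIso.to f i) (OrdIso.to g j)))
Iso-K22⇒K22Pattern (inj₂ (f , g , adj≡)) =
  complete-K22Pattern f g (λ i j → trans (adj≡ i j) (K22-complete (OrdIso.to g j) (OrdIso.to f i)))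

K22≼⇒K22Pattern : ∀ {p q} (G : Mat p q) → K22 ≼ G → K22Pattern G
K22≼⇒K22Pattern G (_ , _ , G' , steps , iso) = Steps-reflect-K22Pattern steps (Iso-K22⇒K22Pattern iso)

identifyA-K22Pattern : ∀ {p q} (M : Mat (suc (suc (suc p))) q) → K22Pattern M →
  Σ (Fin (suc (suc p))) λ t → K22Pattern (identifyA t M)
identifyA-K22Pattern M (k22Pattern rows cols e₁ e₂ e₃ e₄) with mergeIndex-keeps-Below rows
... | t , rows' = t , k22Pattern rows' cols (identifyA-edge⁺ t M _ _ e₁) (identifyA-edge⁺ t M _ _ e₂)
                                           (identifyA-edge⁺ t M _ _ e₃) (identifyA-edge⁺ t M _ _ e₄)

identifyB-K22Pattern : ∀ {p q} (M : Mat p (suc (suc (suc q)))) → K22Pattern M →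
  Σ (Fin (suc (suc q))) λ t → K22Pattern (identifyB t M)
identifyB-K22Pattern M (k22Pattern rows cols e₁ e₂ e₃ e₄) with mergeIndex-keeps-Below cols
... | t , (p₁₂ , p₁₄ , p₃₂ , p₃₄) =
  t , k22Pattern rows (p₁₂ , p₁₄ , p₃₂ , p₃₄) (identifyB-edge⁺ t M _ _ e₁) (identifyB-edge⁺ t M _ _ e₂)
                                              (identifyB-edge⁺ t M _ _ e₃) (identifyB-edge⁺ t M _ _ e₄)

Fin1-≮ : (x y : Fin 1) → ¬ toℕ x < toℕ y
Fin1-≮ zero zero ()

shrinkRows : ∀ {p q} (M : Mat p q) → K22Pattern M → Σ (Mat 2 q) λ M' → Steps M M' × K22Pattern M'
shrinkRows {zero} M pat with K22Pattern.a₁ pat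
... | ()
shrinkRows {suc zero} M pat = ⊥-elim (Fin1-≮ _ _ (proj₁ (K22Pattern.rows pat)))
shrinkRows {suc (suc zero)} M pat = M , done M , pat
shrinkRows {suc (suc (suc p))} M pat =
  let t , pat' = identifyA-K22Pattern M pat
      M' , steps , pat'' = shrinkRows (identifyA t M) pat'
  in M' , step (idA M t) steps , pat''

shrinkCols : ∀ {p q} (M : Mat p q) → K22Pattern M → Σ (Mat p 2) λ M' → Steps M M' × K22Pattern M'
shrinkCols {q = zero} M pat with K22Pattern.b₁ pat
... | ()
shrinkCols {q = suc zero} M pat = ⊥-elim (Fin1-≮ _ _ (proj₁ (K22Pattern.cols pat)))
shrinkCols {q = suc (suc zero)} M pat = M , done M , pat
shrinkCols {q = suc (suc (suc q))} M pat =
  let t , pat' = identifyB-K22Pattern M pat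
      M' , steps , pat'' = shrinkCols (identifyB t M) pat'
  in M' , step (idB M t) steps , pat''

Steps-trans : ∀ {p q p' q' p'' q''} {M : Mat p q} {M' : Mat p' q'} {M'' : Mat p'' q''} →
  Steps M M' → Steps M' M'' → Steps M M''
Steps-trans (done _) steps' = steps'
Steps-trans (step s steps) steps' = step s (Steps-trans steps steps')

Fin2-< : (x y : Fin 2) → toℕ x < toℕ y → x ≡ zero × y ≡ suc zero
Fin2-< zero (suc zero) _ = refl , refl
Fin2-< (suc zero) (suc zero) (s<s ())

K22Pattern-2×2 : (M : Mat 2 2) → K22Pattern M → ∀ a b → adj M a b ≡ true
K22Pattern-2×2 M (k22Pattern (p₁₃ , _ , _ , p₂₄) (p₁₂ , _ , _ , p₃₄) e₁ e₂ e₃ e₄)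
  with Fin2-< _ _ p₁₃ | Fin2-< _ _ p₂₄ | Fin2-< _ _ p₁₂ | Fin2-< _ _ p₃₄
... | refl , refl | refl , refl | refl , refl | refl , refl = λ where
  zero zero → e₁
  zero (suc zero) → e₂
  (suc zero) zero → e₃
  (suc zero) (suc zero) → e₄

K22Pattern⇒K22≼ : ∀ {p q} (G : Mat p q) → K22Pattern G → K22 ≼ G
K22Pattern⇒K22≼ G pat with shrinkRows G pat
... | M , rowSteps , patM with shrinkCols M patM
...   | M' , colSteps , patM' = 2 , 2 , M' , Steps-trans rowSteps colSteps ,
        inj₁ (OrdIso-refl 2 , OrdIso-refl 2 , λ i j → trans (K22Pattern-2×2 M' patM' i j) (sym (K22-complete i j)))

-- Graphs of maps on ℕ

Vec-ext : ∀ {A : Set} {n} {xs ys : Vec A n} → (∀ i → lookup xs i ≡ lookup ys i) → xs ≡ ys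
Vec-ext {xs = xs} {ys} lookup≡ =
  trans (sym (tabulate∘lookup xs)) (trans (tabulate-cong lookup≡) (tabulate∘lookup ys))

Mat-ext : ∀ {p q} {M M' : Mat p q} → (∀ i j → adj M i j ≡ adj M' i j) → M ≡ M'
Mat-ext adj≡ = Vec-ext (λ i → Vec-ext (adj≡ i))

Bool-ext : ∀ {a b} → (a ≡ true ⇔ b ≡ true) → a ≡ b
Bool-ext {true} a⇔b = sym (Equivalence.to a⇔b refl)
Bool-ext {false} {true} a⇔b = Equivalence.from a⇔b refl
Bool-ext {false} {false} _ = refl

≡ᵇ-true⇔ : ∀ a b → (a ≡ᵇ b) ≡ true ⇔ a ≡ b
≡ᵇ-true⇔ a b = mk⇔ (≡ᵇ⇒≡ a b ∘ Equivalence.from T-≡) (Equivalence.to T-≡ ∘ ≡⇒≡ᵇ a b)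

≡ᵇ-refl : ∀ a → (a ≡ᵇ a) ≡ true
≡ᵇ-refl a = Equivalence.from (≡ᵇ-true⇔ a a) refl

≡ᵇ-false : ∀ {a b} → a ≢ b → (a ≡ᵇ b) ≡ false
≡ᵇ-false {a} {b} a≢b = ¬-not (λ e → a≢b (Equivalence.to (≡ᵇ-true⇔ a b) e))

graphOf : ∀ {n} → (ℕ → ℕ) → Mat n n
graphOf τ = tabulate (λ i → tabulate (λ j → toℕ j ≡ᵇ τ (toℕ i)))

adj-graphOf : ∀ {n} (τ : ℕ → ℕ) (i j : Fin n) → adj (graphOf τ) i j ≡ (toℕ j ≡ᵇ τ (toℕ i))
adj-graphOf τ i j = trans (cong (λ row → lookup row j) (lookup∘tabulate _ i)) (lookup∘tabulate _ j)

graphOf-edge : ∀ {n} (τ : ℕ → ℕ) (i j : Fin n) → adj (graphOf τ) i j ≡ true ⇔ toℕ j ≡ τ (toℕ i)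
graphOf-edge τ i j =
  subst (λ b → b ≡ true ⇔ toℕ j ≡ τ (toℕ i)) (sym (adj-graphOf τ i j)) (≡ᵇ-true⇔ (toℕ j) (τ (toℕ i)))

graphOf-oneRegular : ∀ {n} (τ τ⁻¹ : ℕ → ℕ) → (∀ i → i < n → τ i < n) → (∀ j → j < n → τ⁻¹ j < n) →
  (∀ i → i < n → τ⁻¹ (τ i) ≡ i) → (∀ j → j < n → τ (τ⁻¹ j) ≡ j) → OneRegular (graphOf {n} τ)
graphOf-oneRegular {n} τ τ⁻¹ τ<n τ⁻¹<n left right = rowUnique , colUnique
  where
  edge : ∀ i j → toℕ j ≡ τ (toℕ i) → adj (graphOf τ) i j ≡ true
  edge i j = Equivalence.from (graphOf-edge τ i j)
  onEdge : ∀ {i j} → adj (graphOf τ) i j ≡ true → toℕ j ≡ τ (toℕ i)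
  onEdge {i} {j} = Equivalence.to (graphOf-edge τ i j)

  rowUnique : ∀ i → Σ (Fin n) λ j → adj (graphOf τ) i j ≡ true × (∀ j' → adj (graphOf τ) i j' ≡ true → j' ≡ j)
  rowUnique i = j , edge i j (toℕ-fromℕ< _) , λ j' e → toℕ-injective (trans (onEdge e) (sym (toℕ-fromℕ< _)))
    where
    j = fromℕ< (τ<n (toℕ i) (toℕ<n i))

  colUnique : ∀ j → Σ (Fin n) λ i → adj (graphOf τ) i j ≡ true × (∀ i' → adj (graphOf τ) i' j ≡ true → i' ≡ i)
  colUnique j = i , edge i j (sym (trans (cong τ i≡) (right _ (toℕ<n j)))) ,
    λ i' e → toℕ-injective (trans (sym (left _ (toℕ<n i'))) (trans (cong τ⁻¹ (sym (onEdge e))) (sym i≡)))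
    where
    i = fromℕ< (τ⁻¹<n (toℕ j) (toℕ<n j))
    i≡ : toℕ i ≡ τ⁻¹ (toℕ j)
    i≡ = toℕ-fromℕ< _

-- On 4 + m vertices, the only pairs a K22-free matching may put out of order are {0, 1} and {2 + m, 3 + m}.
Exceptional : ℕ → ℕ → ℕ → Set
Exceptional m i j = (i ≡ 0 × j ≡ 1) ⊎ (i ≡ 2 + m × j ≡ 3 + m)

AlmostIncreasing : ℕ → (ℕ → ℕ) → Set
AlmostIncreasing m s = ∀ i j → i < j → j < 4 + m → ¬ Exceptional m i j → s i < s j

AlmostDecreasing : ℕ → (ℕ → ℕ) → Set
AlmostDecreasing m s = ∀ i j → i < j → j < 4 + m → ¬ Exceptional m i j → s j < s i

>2+m⇒≡3+m : ∀ m {x} → 2 + m < x → x < 4 + m → x ≡ 3 + m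
>2+m⇒≡3+m m 2+m<x x<4+m = ≤-antisym (≤-pred x<4+m) 2+m<x

graphOf-K22Pattern-free : ∀ m (τ : ℕ → ℕ) → AlmostIncreasing m τ ⊎ AlmostDecreasing m τ →
  ¬ K22Pattern (graphOf {4 + m} τ)
graphOf-K22Pattern-free m τ monotone
  (k22Pattern {a₁} {a₂} {a₃} {a₄} (p₁₃ , p₁₄ , p₂₃ , p₂₄) (q₁₂ , q₁₄ , q₃₂ , q₃₄) e₁ e₂ e₃ e₄) =
  contradiction monotone
  where
  onEdge : ∀ {i j} → adj (graphOf τ) i j ≡ true → toℕ j ≡ τ (toℕ i)
  onEdge {i} {j} = Equivalence.to (graphOf-edge τ i j)
  a₁≢a₂ : toℕ a₁ ≢ toℕ a₂
  a₁≢a₂ a₁≡a₂ = <-irrefl (trans (onEdge e₁) (trans (cong τ a₁≡a₂) (sym (onEdge e₂)))) q₁₂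
  a₃≢a₄ : toℕ a₃ ≢ toℕ a₄
  a₃≢a₄ a₃≡a₄ = <-irrefl (trans (onEdge e₃) (trans (cong τ a₃≡a₄) (sym (onEdge e₄)))) q₃₄

  contradiction : AlmostIncreasing m τ ⊎ AlmostDecreasing m τ → ⊥
  contradiction (inj₁ increasing) =
    <-asym q₃₂ (subst₂ _<_ (sym (onEdge e₂)) (sym (onEdge e₃)) (increasing _ _ p₂₃ (toℕ<n a₃) exceptional))
    where
    exceptional : ¬ Exceptional m (toℕ a₂) (toℕ a₃)
    exceptional (inj₁ (a₂≡0 , a₃≡1)) = a₁≢a₂ (trans (n<1⇒n≡0 (subst (toℕ a₁ <_) a₃≡1 p₁₃)) (sym a₂≡0))
    exceptional (inj₂ (a₂≡2+m , a₃≡3+m)) =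
      a₃≢a₄ (trans a₃≡3+m (sym (>2+m⇒≡3+m m (subst (_< toℕ a₄) a₂≡2+m p₂₄) (toℕ<n a₄))))
  contradiction (inj₂ decreasing) =
    <-asym q₁₄ (subst₂ _<_ (sym (onEdge e₄)) (sym (onEdge e₁)) (decreasing _ _ p₁₄ (toℕ<n a₄) exceptional))
    where
    exceptional : ¬ Exceptional m (toℕ a₁) (toℕ a₄)
    exceptional (inj₁ (a₁≡0 , a₄≡1)) = a₁≢a₂ (trans a₁≡0 (sym (n<1⇒n≡0 (subst (toℕ a₂ <_) a₄≡1 p₂₄))))
    exceptional (inj₂ (a₁≡2+m , a₄≡3+m)) =
      a₃≢a₄ (trans (>2+m⇒≡3+m m (subst (_< toℕ a₃) a₁≡2+m p₁₃) (toℕ<n a₃)) (sym a₄≡3+m))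

-- The eight matchings

swapAt : ℕ → ℕ → ℕ
swapAt zero zero = 1
swapAt zero (suc zero) = 0
swapAt zero (suc (suc x)) = suc (suc x)
swapAt (suc k) zero = zero
swapAt (suc k) (suc x) = suc (swapAt k x)

swapAt-involutive : ∀ k x → swapAt k (swapAt k x) ≡ x
swapAt-involutive zero zero = refl
swapAt-involutive zero (suc zero) = refl
swapAt-involutive zero (suc (suc x)) = refl
swapAt-involutive (suc k) zero = refl
swapAt-involutive (suc k) (suc x) = cong suc (swapAt-involutive k x)

swapAt-< : ∀ {n} k x → suc k < n → x < n → swapAt k x < n
swapAt-< zero zero 1<n _ = 1<n
swapAt-< zero (suc zero) _ 1<n = <-trans z<s 1<n
swapAt-< zero (suc (suc x)) _ x<n = x<n
swapAt-< (suc k) zero _ 0<n = 0<n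
swapAt-< {suc n} (suc k) (suc x) (s<s k<n) (s<s x<n) = s<s (swapAt-< k x k<n x<n)

swapAt-mono-< : ∀ k {x y} → x < y → ¬ (x ≡ k × y ≡ suc k) → swapAt k x < swapAt k y
swapAt-mono-< zero {zero} {suc zero} _ unswapped = ⊥-elim (unswapped (refl , refl))
swapAt-mono-< zero {zero} {suc (suc y)} _ _ = s<s z<s
swapAt-mono-< zero {suc zero} {suc zero} (s<s ()) _
swapAt-mono-< zero {suc zero} {suc (suc y)} _ _ = z<s
swapAt-mono-< zero {suc (suc x)} {suc zero} (s<s ()) _
swapAt-mono-< zero {suc (suc x)} {suc (suc y)} x<y _ = x<y
swapAt-mono-< (suc k) {zero} {suc y} _ _ = z<s
swapAt-mono-< (suc k) {suc x} {suc y} (s<s x<y) unswapped =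
  s<s (swapAt-mono-< k x<y (λ (x≡k , y≡k+1) → unswapped (cong suc x≡k , cong suc y≡k+1)))

swapAt-below : ∀ k x → x < k → swapAt k x ≡ x
swapAt-below (suc k) zero _ = refl
swapAt-below (suc k) (suc x) (s<s x<k) = cong suc (swapAt-below k x x<k)

swapAt-self : ∀ k → swapAt k k ≡ suc k
swapAt-self zero = refl
swapAt-self (suc k) = cong suc (swapAt-self k)

swapAt-suc : ∀ k → swapAt k (suc k) ≡ k
swapAt-suc zero = refl
swapAt-suc (suc k) = cong suc (swapAt-suc k)

swapIf : Bool → ℕ → ℕ → ℕ
swapIf false k x = x
swapIf true k x = swapAt k x

swapIf-involutive : ∀ b k x → swapIf b k (swapIf b k x) ≡ x
swapIf-involutive false k x = refl
swapIf-involutive true k x = swapAt-involutive k x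

swapIf-< : ∀ {n} b k x → suc k < n → x < n → swapIf b k x < n
swapIf-< false k x _ x<n = x<n
swapIf-< true k x k+1<n x<n = swapAt-< k x k+1<n x<n

swapIf-mono-< : ∀ b k {x y} → x < y → ¬ (x ≡ k × y ≡ suc k) → swapIf b k x < swapIf b k y
swapIf-mono-< false k x<y _ = x<y
swapIf-mono-< true k x<y unswapped = swapAt-mono-< k x<y unswapped

swapIf-below : ∀ b k x → x < k → swapIf b k x ≡ x
swapIf-below false k x _ = refl
swapIf-below true k x x<k = swapAt-below k x x<k

swapIf-0-above : ∀ b x → swapIf b 0 (suc (suc x)) ≡ suc (suc x)
swapIf-0-above false x = refl
swapIf-0-above true x = refl

distinct-pair : ∀ k {x y} → k ≤ x → x ≤ suc k → k ≤ y → y ≤ suc k → x ≢ y →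
  Σ Bool λ b → x ≡ swapIf b k k × y ≡ swapIf b k (suc k)
distinct-pair k k≤x x≤k+1 k≤y y≤k+1 x≢y with m≤n⇒m<n∨m≡n k≤x | m≤n⇒m<n∨m≡n k≤y
... | inj₂ refl | inj₂ refl = ⊥-elim (x≢y refl)
... | inj₂ refl | inj₁ k<y = false , refl , ≤-antisym y≤k+1 k<y
... | inj₁ k<x | inj₂ refl = true , trans (≤-antisym x≤k+1 k<x) (sym (swapAt-self k)) , sym (swapAt-suc k)
... | inj₁ k<x | inj₁ k<y = ⊥-elim (x≢y (trans (≤-antisym x≤k+1 k<x) (sym (≤-antisym y≤k+1 k<y))))

almostId : Bool → Bool → ℕ → ℕ → ℕ
almostId f l m = swapIf f 0 ∘ swapIf l (2 + m)

-- The two swaps have disjoint supports.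
swapIf-0-comm : ∀ f l m x → swapIf l (2 + m) (swapIf f 0 x) ≡ swapIf f 0 (swapIf l (2 + m) x)
swapIf-0-comm false l m x = refl
swapIf-0-comm true false m x = refl
swapIf-0-comm true true m zero = refl
swapIf-0-comm true true m (suc zero) = refl
swapIf-0-comm true true m (suc (suc x)) = refl

almostId-involutive : ∀ f l m x → almostId f l m (almostId f l m x) ≡ x
almostId-involutive f l m x = begin
  swapIf f 0 (swapIf l (2 + m) (swapIf f 0 (swapIf l (2 + m) x)))
    ≡⟨ cong (swapIf f 0) (swapIf-0-comm f l m _) ⟩
  swapIf f 0 (swapIf f 0 (swapIf l (2 + m) (swapIf l (2 + m) x)))
    ≡⟨ swapIf-involutive f 0 _ ⟩
  swapIf l (2 + m) (swapIf l (2 + m) x)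
    ≡⟨ swapIf-involutive l (2 + m) x ⟩
  x ∎
  where open ≡-Reasoning

almostId-< : ∀ f l m x → x < 4 + m → almostId f l m x < 4 + m
almostId-< f l m x x<n = swapIf-< f 0 _ (s<s z<s) (swapIf-< l (2 + m) x ≤-refl x<n)

almostId-increasing : ∀ f l m → AlmostIncreasing m (almostId f l m)
almostId-increasing f l m i j i<j _ notExceptional =
  swapIf-mono-< f 0 (swapIf-mono-< l (2 + m) i<j (notExceptional ∘ inj₂))
    (λ (e₀ , e₁) → notExceptional (inj₁ (unswap i e₀ z<s , unswap j e₁ (s<s z<s))))
  where
  unswap : ∀ x {y} → swapIf l (2 + m) x ≡ y → y < 2 + m → x ≡ y
  unswap x {y} e y<2+m = trans (sym (swapIf-involutive l (2 + m) x))
    (trans (cong (swapIf l (2 + m)) e) (swapIf-below l (2 + m) y y<2+m))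

-- Reverses 0, …, 3 + m; larger numbers are sent to 0.
flip : ℕ → ℕ → ℕ
flip m x = 3 + m ∸ x

flip-< : ∀ m x → flip m x < 4 + m
flip-< m x = s≤s (m∸n≤m _ x)

flip-involutive : ∀ m x → x < 4 + m → flip m (flip m x) ≡ x
flip-involutive m x x<n = m∸[m∸n]≡n (≤-pred x<n)

flip-reverses-< : ∀ m {x y} → x < y → y < 4 + m → flip m y < flip m x
flip-reverses-< m x<y y<n = ∸-monoʳ-< x<y (≤-pred y<n)

flipIf : Bool → ℕ → ℕ → ℕ
flipIf false m x = x
flipIf true m x = flip m x

flipIf-< : ∀ b m x → x < 4 + m → flipIf b m x < 4 + m
flipIf-< false m x x<n = x<n
flipIf-< true m x _ = flip-< m x

flipIf-involutive : ∀ b m x → x < 4 + m → flipIf b m (flipIf b m x) ≡ x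
flipIf-involutive false m x _ = refl
flipIf-involutive true m x x<n = flip-involutive m x x<n

flipIf-injective : ∀ b m {x y} → x < 4 + m → y < 4 + m → flipIf b m x ≡ flipIf b m y → x ≡ y
flipIf-injective b m {x} {y} x<n y<n e =
  trans (sym (flipIf-involutive b m x x<n)) (trans (cong (flipIf b m) e) (flipIf-involutive b m y y<n))

flip-penultimate : ∀ m → flip m (2 + m) ≡ 1
flip-penultimate m = m+n∸n≡m 1 m

flip-last : ∀ m → flip m (3 + m) ≡ 0
flip-last m = n∸n≡0 (3 + m)

flip-middle : ∀ m k → k < m → flip m (2 + k) ≡ 2 + (m ∸ suc k)
flip-middle (suc m) zero _ = refl
flip-middle (suc m) (suc k) (s<s k<m) = flip-middle m k k<m

swapIf-penultimate : ∀ b m → swapIf b (2 + m) (2 + m) ≡ flip m (swapIf b 0 1)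
swapIf-penultimate false m = refl
swapIf-penultimate true m = swapAt-self (2 + m)

swapIf-last : ∀ b m → swapIf b (2 + m) (3 + m) ≡ flip m (swapIf b 0 0)
swapIf-last false m = refl
swapIf-last true m = swapAt-suc (2 + m)

swapIf-0-<2 : ∀ b x → x < 2 → swapIf b 0 x < 2
swapIf-0-<2 b x x<2 = swapIf-< b 0 x ≤-refl x<2

flip-low : ∀ m {y} → y < 2 → 1 < flip m y
flip-low m {zero} _ = s≤s (s≤s z≤n)
flip-low m {suc zero} _ = s≤s (s≤s z≤n)
flip-low m {suc (suc y)} (s<s (s<s ()))

flipIf-low-injective : ∀ d d' m {x y} → x < 2 → y < 2 → flipIf d m x ≡ flipIf d' m y → d ≡ d'
flipIf-low-injective false false m _ _ _ = refl
flipIf-low-injective true true m _ _ _ = refl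
flipIf-low-injective false true m x<2 y<2 x≡flip = ⊥-elim (<⇒≱ (subst (1 <_) (sym x≡flip) (flip-low m y<2)) (≤-pred x<2))
flipIf-low-injective true false m x<2 y<2 flip≡y = ⊥-elim (<⇒≱ (subst (1 <_) flip≡y (flip-low m x<2)) (≤-pred y<2))

swapIf-0-injective : ∀ b b' → swapIf b 0 0 ≡ swapIf b' 0 0 → b ≡ b'
swapIf-0-injective false false _ = refl
swapIf-0-injective true true _ = refl

-- The eight matchings of the theorem as maps A → B: f and l exchange the first and the last two vertices,
-- d reverses B.
candidate : Bool → Bool → Bool → ℕ → ℕ → ℕ
candidate d f l m = flipIf d m ∘ almostId f l m

candidate-< : ∀ d f l m x → x < 4 + m → candidate d f l m x < 4 + m
candidate-< d f l m x x<n = flipIf-< d m _ (almostId-< f l m x x<n)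

candidate-monotone : ∀ d f l m → AlmostIncreasing m (candidate d f l m) ⊎ AlmostDecreasing m (candidate d f l m)
candidate-monotone false f l m = inj₁ (almostId-increasing f l m)
candidate-monotone true f l m = inj₂ λ i j i<j j<n notExceptional →
  flip-reverses-< m (almostId-increasing f l m i j i<j j<n notExceptional) (almostId-< f l m j j<n)

candidate-oneRegular : ∀ d f l m → OneRegular (graphOf {4 + m} (candidate d f l m))
candidate-oneRegular d f l m = graphOf-oneRegular (candidate d f l m) (almostId f l m ∘ flipIf d m)
  (candidate-< d f l m) (λ y y<n → almostId-< f l m _ (flipIf-< d m y y<n))
  (λ x x<n → trans (cong (almostId f l m) (flipIf-involutive d m _ (almostId-< f l m x x<n)))
                   (almostId-involutive f l m x))
  (λ y y<n → trans (cong (flipIf d m) (almostId-involutive f l m _)) (flipIf-involutive d m y y<n))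

candidate-K22-free : ∀ d f l m → ¬ (K22 ≼ graphOf {4 + m} (candidate d f l m))
candidate-K22-free d f l m =
  graphOf-K22Pattern-free m (candidate d f l m) (candidate-monotone d f l m) ∘ K22≼⇒K22Pattern _

-- Separated permutations

InjectiveOn : ℕ → (ℕ → ℕ) → Set
InjectiveOn n s = ∀ x y → x < n → y < n → s x ≡ s y → x ≡ y

InjectiveOn⇒≤ : ∀ (s : ℕ → ℕ) a b → (∀ x → x < a → s x < b) → InjectiveOn a s → a ≤ b
InjectiveOn⇒≤ s a b s<b injective with a ≤? b
... | yes a≤b = a≤b
... | no a≰b with pigeonhole (≰⇒> a≰b) (λ x → fromℕ< (s<b (toℕ x) (toℕ<n x)))
...   | x , y , x<y , sx≡sy = ⊥-elim (<-irrefl (injective _ _ (toℕ<n x) (toℕ<n y)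
        (trans (sym (toℕ-fromℕ< _)) (trans (cong toℕ sx≡sy) (toℕ-fromℕ< _)))) x<y)

<∸⇒+< : ∀ c {k n} → k < n ∸ c → c + k < n
<∸⇒+< zero k<n = k<n
<∸⇒+< (suc c) {n = suc n} k<n∸c = s<s (<∸⇒+< c k<n∸c)

module Counting {n} {s : ℕ → ℕ} (injective : InjectiveOn n s) (s<n : ∀ x → x < n → s x < n) where

  count-below : ∀ c i → c ≤ n → (∀ k → k < c → s k < s i) → c ≤ s i
  count-below c i c≤n below = InjectiveOn⇒≤ s c (s i) below
    (λ x y x<c y<c → injective x y (<-≤-trans x<c c≤n) (<-≤-trans y<c c≤n))

  -- The values s k for c < k < n are distinct and lie strictly between s i and n.
  count-above : ∀ c i → i < n → (∀ k → c < k → k < n → s i < s k) → s i ≤ c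
  count-above c i i<n above = ≤-pred (∸-cancelʳ-≤ (s<n i i<n) (InjectiveOn⇒≤ shifted (n ∸ suc c) (n ∸ suc (s i))
    (λ k k< → ∸-monoˡ-< (s<n _ (<∸⇒+< (suc c) k<)) (above _ (s≤s (m≤m+n c k)) (<∸⇒+< (suc c) k<)))
    (λ x y x< y< e → +-cancelˡ-≡ (suc c) x y (injective _ _ (<∸⇒+< (suc c) x<) (<∸⇒+< (suc c) y<)
      (∸-cancelʳ-≡ (above _ (s≤s (m≤m+n c x)) (<∸⇒+< (suc c) x<))
                   (above _ (s≤s (m≤m+n c y)) (<∸⇒+< (suc c) y<)) e)))))
    where
    shifted : ℕ → ℕ
    shifted k = s (suc c + k) ∸ suc (s i)

data Position (m : ℕ) : ℕ → Set where
  first : Position m 0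
  second : Position m 1
  middle : ∀ {k} → k < m → Position m (2 + k)
  penultimate : Position m (2 + m)
  last : Position m (3 + m)

position : ∀ m {i} → i < 4 + m → Position m i
position m {zero} _ = first
position m {suc zero} _ = second
position m {suc (suc k)} (s<s (s<s k<2+m)) with <-cmp k m
... | tri< k<m _ _ = middle k<m
... | tri≈ _ refl _ = penultimate
... | tri> _ _ m<k with ≤-antisym (≤-pred k<2+m) m<k
...   | refl = last

almostId-first : ∀ f l m → almostId f l m 0 ≡ swapIf f 0 0
almostId-first f false m = refl
almostId-first f true m = refl

almostId-second : ∀ f l m → almostId f l m 1 ≡ swapIf f 0 1
almostId-second f false m = refl
almostId-second f true m = refl

almostId-middle : ∀ f l m {k} → k < m → almostId f l m (2 + k) ≡ 2 + k
almostId-middle f l m {k} k<m = trans (cong (swapIf f 0) (swapIf-below l (2 + m) (2 + k) (s<s (s<s k<m))))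
  (swapIf-0-above f k)

almostId-penultimate : ∀ f l m → almostId f l m (2 + m) ≡ swapIf l (2 + m) (2 + m)
almostId-penultimate f false m = swapIf-0-above f m
almostId-penultimate f true m = swapIf-0-above f (swapAt m m)

almostId-last : ∀ f l m → almostId f l m (3 + m) ≡ swapIf l (2 + m) (3 + m)
almostId-last f false m = swapIf-0-above f (suc m)
almostId-last f true m = swapIf-0-above f (swapAt m (suc m))

module AlmostIncreasingBounds {m} {s : ℕ → ℕ} (injective : InjectiveOn (4 + m) s)
  (s<n : ∀ x → x < 4 + m → s x < 4 + m) (increasing : AlmostIncreasing m s) where

  open Counting injective s<n

  2+m<n : 2 + m < 4 + m
  2+m<n = s≤s (s≤s (s≤s (n≤1+n m)))

  middle-fixed : ∀ {k} → k < m → s (2 + k) ≡ 2 + k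
  middle-fixed {k} k<m = ≤-antisym
    (count-above (2 + k) (2 + k) i<n λ j i<j j<n → increasing _ j i<j j<n λ where
      (inj₁ (() , _))
      (inj₂ (i≡2+m , _)) → <-irrefl (suc-injective (suc-injective i≡2+m)) k<m)
    (count-below (2 + k) (2 + k) (<⇒≤ i<n) λ j j<i → increasing j _ j<i i<n λ where
      (inj₁ (_ , ()))
      (inj₂ (_ , i≡3+m)) → <-irrefl (suc-injective (suc-injective i≡3+m)) (<-trans k<m (n<1+n m)))
    where
    i<n : 2 + k < 4 + m
    i<n = s<s (s<s (<-trans k<m (<-trans (n<1+n m) (n<1+n (suc m)))))

  first-≤1 : s 0 ≤ 1
  first-≤1 = count-above 1 0 z<s λ j 1<j j<n → increasing 0 j (<-trans z<s 1<j) j<n λ where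
    (inj₁ (_ , j≡1)) → <-irrefl (sym j≡1) 1<j
    (inj₂ (() , _))

  second-≤1 : s 1 ≤ 1
  second-≤1 = count-above 1 1 (s<s z<s) λ j 1<j j<n → increasing 1 j 1<j j<n λ where
    (inj₁ (() , _))
    (inj₂ (() , _))

  penultimate-≥2+m : 2 + m ≤ s (2 + m)
  penultimate-≥2+m = count-below (2 + m) (2 + m) (<⇒≤ 2+m<n) λ j j<2+m → increasing j _ j<2+m 2+m<n λ where
    (inj₁ (_ , ()))
    (inj₂ (j≡2+m , _)) → <-irrefl j≡2+m j<2+m

  last-≥2+m : 2 + m ≤ s (3 + m)
  last-≥2+m = count-below (2 + m) (3 + m) (<⇒≤ 2+m<n) λ j j<2+m →
    increasing j _ (<-trans j<2+m (n<1+n _)) ≤-refl λ where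
      (inj₁ (_ , ()))
      (inj₂ (j≡2+m , _)) → <-irrefl j≡2+m j<2+m

almostIncreasing⇒almostId : ∀ m {s : ℕ → ℕ} → InjectiveOn (4 + m) s → (∀ x → x < 4 + m → s x < 4 + m) →
  AlmostIncreasing m s → Σ Bool λ f → Σ Bool λ l → ∀ i → i < 4 + m → s i ≡ almostId f l m i
almostIncreasing⇒almostId m {s} injective s<n increasing = f , l , agree
  where
  open AlmostIncreasingBounds injective s<n increasing

  firstPair = distinct-pair 0 z≤n first-≤1 z≤n second-≤1 (λ e → 0≢1+n (injective 0 1 z<s (s<s z<s) e))
  f = proj₁ firstPair

  lastPair = distinct-pair (2 + m) penultimate-≥2+m (≤-pred (s<n _ 2+m<n)) last-≥2+m (≤-pred (s<n _ ≤-refl))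
    (λ e → <-irrefl (injective _ _ 2+m<n ≤-refl e) (n<1+n _))
  l = proj₁ lastPair

  agree : ∀ i → i < 4 + m → s i ≡ almostId f l m i
  agree i i<n with position m i<n
  ... | first = trans (proj₁ (proj₂ firstPair)) (sym (almostId-first f l m))
  ... | second = trans (proj₂ (proj₂ firstPair)) (sym (almostId-second f l m))
  ... | middle k<m = trans (middle-fixed k<m) (sym (almostId-middle f l m k<m))
  ... | penultimate = trans (proj₁ (proj₂ lastPair)) (sym (almostId-penultimate f l m))
  ... | last = trans (proj₂ (proj₂ lastPair)) (sym (almostId-last f l m))

-- For the partner map of a perfect matching this is the absence of a K22 pattern.
Separated : ℕ → (ℕ → ℕ) → Set
Separated n s = ∀ {a b c d} → a < b → b < c → c < d → d < n →
  Below (s a) (s b) (s c) (s d) ⊎ Below (s c) (s d) (s a) (s b)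

AllBelow : ℕ → (ℕ → ℕ) → Set
AllBelow n s = ∀ {a b c d} → a < b → b < c → c < d → d < n → Below (s a) (s b) (s c) (s d)

resolve : ∀ {A B : Set} {x y} → x < y → A ⊎ B → (B → y < x) → A
resolve _ (inj₁ a) _ = a
resolve x<y (inj₂ b) y<x = ⊥-elim (<-asym x<y (y<x b))

-- Two quadruples sharing a comparison are separated the same way; four such moves lead from 0, 1, 2, 3 to any
-- quadruple.
Separated⇒AllBelow : ∀ {n s} → Separated n s → Below (s 0) (s 1) (s 2) (s 3) → AllBelow n s
Separated⇒AllBelow {s = s} separated below₀₁₂₃ {a} {b} {c} {d} a<b b<c c<d d<n =
  resolve (proj₁ (proj₂ (proj₂ below₀bcd))) (separated a<b b<c c<d d<n) (proj₁ ∘ proj₂)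
  where
  0<b = <-≤-trans z<s a<b
  1<c = <-≤-trans (s<s z<s) (≤-trans (s≤s 0<b) b<c)
  2<d = <-≤-trans (s<s (s<s z<s)) (≤-trans (s≤s 1<c) c<d)
  below₀₁₂d : Below (s 0) (s 1) (s 2) (s d)
  below₀₁₂d = resolve (proj₁ below₀₁₂₃) (separated z<s (s<s z<s) 2<d d<n) proj₁
  below₀₁cd : Below (s 0) (s 1) (s c) (s d)
  below₀₁cd = resolve (proj₁ (proj₂ below₀₁₂d)) (separated z<s 1<c c<d d<n) (proj₁ ∘ proj₂ ∘ proj₂)
  below₀bcd : Below (s 0) (s b) (s c) (s d)
  below₀bcd = resolve (proj₁ below₀₁cd) (separated 0<b b<c c<d d<n) proj₁

AllBelow⇒AlmostIncreasing : ∀ m {s} → AllBelow (4 + m) s → AlmostIncreasing m s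
AllBelow⇒AlmostIncreasing m allBelow i j i<j j<n notExceptional with i ≟ 0 | j ≟ 3 + m
... | yes refl | no j≢3+m = proj₁ (allBelow z<s 1<j (≤∧≢⇒< (≤-pred j<n) j≢3+m) ≤-refl)
  where
  1<j : 1 < j
  1<j = ≤∧≢⇒< i<j (λ 1≡j → notExceptional (inj₁ (refl , sym 1≡j)))
... | yes refl | yes refl = proj₁ (proj₂ (allBelow z<s (s<s (s<s z≤n)) (n<1+n _) ≤-refl))
... | no i≢0 | no j≢3+m =
  proj₁ (proj₂ (proj₂ (allBelow (n≢0⇒n>0 i≢0) i<j (≤∧≢⇒< (≤-pred j<n) j≢3+m) ≤-refl)))
... | no i≢0 | yes refl =
  proj₂ (proj₂ (proj₂ (allBelow (n≢0⇒n>0 i≢0) i<2+m (n<1+n _) ≤-refl)))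
  where
  i<2+m = ≤∧≢⇒< (≤-pred i<j) (λ i≡2+m → notExceptional (inj₂ (i≡2+m , refl)))

Below-flip : ∀ m {a b c d} → Below a b c d → c < 4 + m → d < 4 + m → Below (flip m c) (flip m d) (flip m a) (flip m b)
Below-flip m (a<c , a<d , b<c , b<d) c<n d<n =
  flip-reverses-< m a<c c<n , flip-reverses-< m b<c c<n , flip-reverses-< m a<d d<n , flip-reverses-< m b<d d<n

flipIf-Separated : ∀ b m {s} → (∀ x → x < 4 + m → s x < 4 + m) → Separated (4 + m) s → Separated (4 + m) (flipIf b m ∘ s)
flipIf-Separated false m s<n separated = separated
flipIf-Separated true m s<n separated a<b b<c c<d d<n with separated a<b b<c c<d d<n
... | inj₁ below = inj₂ (Below-flip m below (s<n _ c<n) (s<n _ d<n))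
  where c<n = <-trans c<d d<n
... | inj₂ above = inj₁ (Below-flip m above (s<n _ a<n) (s<n _ b<n))
  where b<n = <-trans b<c (<-trans c<d d<n)
        a<n = <-trans a<b b<n

Separated⇒candidate : ∀ m {s : ℕ → ℕ} → InjectiveOn (4 + m) s → (∀ x → x < 4 + m → s x < 4 + m) →
  Separated (4 + m) s → Σ Bool λ d → Σ Bool λ f → Σ Bool λ l → ∀ i → i < 4 + m → s i ≡ candidate d f l m i
Separated⇒candidate m {s} injective s<n separated = d , f , l ,
  λ i i<n → trans (sym (flipIf-involutive d m _ (s<n i i<n))) (cong (flipIf d m) (agree i i<n))
  where
  3<n : 3 < 4 + m
  3<n = s≤s (s≤s (s≤s (s≤s z≤n)))

  oriented : Σ Bool λ d → Below (flipIf d m (s 0)) (flipIf d m (s 1)) (flipIf d m (s 2)) (flipIf d m (s 3))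
  oriented with separated z<s (s<s z<s) (s<s (s<s z<s)) 3<n
  ... | inj₁ below = false , below
  ... | inj₂ above = true , Below-flip m above (s<n 0 (<-trans z<s 3<n)) (s<n 1 (<-trans (s<s z<s) 3<n))
  d = proj₁ oriented

  s' : ℕ → ℕ
  s' = flipIf d m ∘ s

  s'-injective : InjectiveOn (4 + m) s'
  s'-injective x y x<n y<n e = injective x y x<n y<n (flipIf-injective d m (s<n x x<n) (s<n y y<n) e)

  classified = almostIncreasing⇒almostId m s'-injective (λ x x<n → flipIf-< d m _ (s<n x x<n))
    (AllBelow⇒AlmostIncreasing m (Separated⇒AllBelow (flipIf-Separated d m s<n separated) (proj₂ oriented)))
  f = proj₁ classified
  l = proj₁ (proj₂ classified)
  agree = proj₂ (proj₂ classified)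

-- Perfect matchings without K22 interval minor

Below-≡ : ∀ {a b c d a' b' c' d'} → a ≡ a' → b ≡ b' → c ≡ c' → d ≡ d' → Below a b c d → Below a' b' c' d'
Below-≡ refl refl refl refl below = below

Below-swapˡ : ∀ {a b c d} → Below a b c d → Below b a c d
Below-swapˡ (a<c , a<d , b<c , b<d) = b<c , b<d , a<c , a<d

Below-swapʳ : ∀ {a b c d} → Below a b c d → Below a b d c
Below-swapʳ (a<c , a<d , b<c , b<d) = a<d , a<c , b<d , b<c

sorted⇒Separated : ∀ {n} {s : ℕ → ℕ} → InjectiveOn n s →
  (∀ {p q r t} → Below p q r t → r < n → t < n → s p < s q → s r < s t →
     Below (s p) (s q) (s r) (s t) ⊎ Below (s r) (s t) (s p) (s q)) →
  Separated n s
sorted⇒Separated {n} {s} injective sorted {a} {b} {c} {d} a<b b<c c<d d<n =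
  byOrder (<-cmp (s a) (s b)) (<-cmp (s c) (s d))
  where
  c<n = <-trans c<d d<n
  b<n = <-trans b<c c<n
  a<n = <-trans a<b b<n
  rows : Below a b c d
  rows = <-trans a<b b<c , <-trans a<b (<-trans b<c c<d) , b<c , <-trans b<c c<d

  byOrder : Tri (s a < s b) (s a ≡ s b) (s b < s a) → Tri (s c < s d) (s c ≡ s d) (s d < s c) →
    Below (s a) (s b) (s c) (s d) ⊎ Below (s c) (s d) (s a) (s b)
  byOrder (tri≈ _ sa≡sb _) _ = ⊥-elim (<-irrefl (injective a b a<n b<n sa≡sb) a<b)
  byOrder _ (tri≈ _ sc≡sd _) = ⊥-elim (<-irrefl (injective c d c<n d<n sc≡sd) c<d)
  byOrder (tri< sa<sb _ _) (tri< sc<sd _ _) = sorted rows c<n d<n sa<sb sc<sd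
  byOrder (tri< sa<sb _ _) (tri> _ _ sd<sc) =
    ⊎-map Below-swapʳ Below-swapˡ (sorted (Below-swapʳ rows) d<n c<n sa<sb sd<sc)
  byOrder (tri> _ _ sb<sa) (tri< sc<sd _ _) =
    ⊎-map Below-swapˡ Below-swapʳ (sorted (Below-swapˡ rows) c<n d<n sb<sa sc<sd)
  byOrder (tri> _ _ sb<sa) (tri> _ _ sd<sc) =
    ⊎-map (Below-swapˡ ∘ Below-swapʳ) (Below-swapˡ ∘ Below-swapʳ)
      (sorted (Below-swapˡ (Below-swapʳ rows)) d<n c<n sb<sa sd<sc)

module Partner {n} (G : Mat n n) (regular : OneRegular G) where

  partner : Fin n → Fin n
  partner i = proj₁ (proj₁ regular i)

  partner-edge : ∀ i → adj G i (partner i) ≡ true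
  partner-edge i = proj₁ (proj₂ (proj₁ regular i))

  partner-unique : ∀ i j → adj G i j ≡ true → j ≡ partner i
  partner-unique i = proj₂ (proj₂ (proj₁ regular i))

  partner-injective : ∀ i i' → partner i ≡ partner i' → i ≡ i'
  partner-injective i i' e = trans (unique i (partner-edge i))
    (sym (unique i' (subst (λ j → adj G i' j ≡ true) (sym e) (partner-edge i'))))
    where
    unique : ∀ x → adj G x (partner i) ≡ true → x ≡ proj₁ (proj₂ regular (partner i))
    unique = proj₂ (proj₂ (proj₂ regular (partner i)))

  -- Junk value 0 outside [0, n).
  partnerℕ : ℕ → ℕ
  partnerℕ x with x <? n
  ... | yes x<n = toℕ (partner (fromℕ< x<n))
  ... | no _ = 0

  partnerℕ-fromℕ< : ∀ x (x<n : x < n) → partnerℕ x ≡ toℕ (partner (fromℕ< x<n))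
  partnerℕ-fromℕ< x x<n with x <? n
  ... | yes _ = refl
  ... | no x≮n = ⊥-elim (x≮n x<n)

  partnerℕ-toℕ : ∀ i → partnerℕ (toℕ i) ≡ toℕ (partner i)
  partnerℕ-toℕ i = trans (partnerℕ-fromℕ< _ (toℕ<n i)) (cong (toℕ ∘ partner) (fromℕ<-toℕ i (toℕ<n i)))

  partnerℕ-< : ∀ x → x < n → partnerℕ x < n
  partnerℕ-< x x<n = subst (_< n) (sym (partnerℕ-fromℕ< x x<n)) (toℕ<n _)

  partnerℕ-injective : InjectiveOn n partnerℕ
  partnerℕ-injective x y x<n y<n e = trans (sym (toℕ-fromℕ< x<n)) (trans (cong toℕ fromℕ<≡) (toℕ-fromℕ< y<n))
    where
    fromℕ<≡ : fromℕ< x<n ≡ fromℕ< y<n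
    fromℕ<≡ = partner-injective _ _ (toℕ-injective
      (trans (sym (partnerℕ-fromℕ< x x<n)) (trans e (partnerℕ-fromℕ< y y<n))))

  ≡graphOf : (τ : ℕ → ℕ) → (∀ x → x < n → partnerℕ x ≡ τ x) → G ≡ graphOf τ
  ≡graphOf τ agree = Mat-ext λ i j → Bool-ext (mk⇔
    (λ e → Equivalence.from (graphOf-edge τ i j) (trans (cong toℕ (partner-unique i j e)) (partner≡τ i)))
    (λ e → subst (λ j → adj G i j ≡ true)
      (sym (toℕ-injective (trans (Equivalence.to (graphOf-edge τ i j) e) (sym (partner≡τ i))))) (partner-edge i)))
    where
    partner≡τ : ∀ i → toℕ (partner i) ≡ τ (toℕ i)
    partner≡τ i = trans (sym (partnerℕ-toℕ i)) (agree (toℕ i) (toℕ<n i))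

  interleaved-K22Pattern : ∀ {p q r t} → Below p q r t → r < n → t < n →
    Below (partnerℕ p) (partnerℕ r) (partnerℕ q) (partnerℕ t) → K22Pattern G
  interleaved-K22Pattern {p} {q} {r} {t} rows@(p<r , _ , q<r , _) r<n t<n cols =
    k22Pattern
      (Below-≡ (sym (toℕ-fromℕ< _)) (sym (toℕ-fromℕ< _)) (sym (toℕ-fromℕ< _)) (sym (toℕ-fromℕ< _)) rows)
      (Below-≡ (partnerℕ-fromℕ< p p<n) (partnerℕ-fromℕ< r r<n) (partnerℕ-fromℕ< q q<n) (partnerℕ-fromℕ< t t<n) cols)
      (partner-edge _) (partner-edge _) (partner-edge _) (partner-edge _)
    where
    p<n = <-trans p<r r<n
    q<n = <-trans q<r r<n

  K22-free⇒Separated : ¬ (K22 ≼ G) → Separated n partnerℕ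
  K22-free⇒Separated K22-free = sorted⇒Separated partnerℕ-injective separate
    where
    separate : ∀ {p q r t} → Below p q r t → r < n → t < n → partnerℕ p < partnerℕ q → partnerℕ r < partnerℕ t →
      Below (partnerℕ p) (partnerℕ q) (partnerℕ r) (partnerℕ t) ⊎
      Below (partnerℕ r) (partnerℕ t) (partnerℕ p) (partnerℕ q)
    separate {p} {q} {r} {t} rows@(p<r , p<t , q<r , q<t) r<n t<n sp<sq sr<st
      with <-cmp (partnerℕ q) (partnerℕ r) | <-cmp (partnerℕ t) (partnerℕ p)
    ... | tri< sq<sr _ _ | _ = inj₁ (<-trans sp<sq sq<sr , <-trans sp<sq (<-trans sq<sr sr<st) , sq<sr , <-trans sq<sr sr<st)
    ... | _ | tri< st<sp _ _ = inj₂ (<-trans sr<st st<sp , <-trans sr<st (<-trans st<sp sp<sq) , st<sp , <-trans st<sp sp<sq)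
    ... | tri≈ _ sq≡sr _ | _ = ⊥-elim (<-irrefl (partnerℕ-injective _ _ (<-trans q<r r<n) r<n sq≡sr) q<r)
    ... | _ | tri≈ _ st≡sp _ = ⊥-elim (<-irrefl (partnerℕ-injective _ _ (<-trans p<t t<n) t<n (sym st≡sp)) p<t)
    ... | tri> _ _ sr<sq | tri> _ _ sp<st =
      ⊥-elim (K22-free (K22Pattern⇒K22≼ G (interleaved-K22Pattern rows r<n t<n (sp<sq , sp<st , sr<sq , sr<st))))

OneRegular∧K22-free⇒candidate : ∀ m (G : Mat (4 + m) (4 + m)) → OneRegular G → ¬ (K22 ≼ G) →
  Σ Bool λ d → Σ Bool λ f → Σ Bool λ l → G ≡ graphOf (candidate d f l m)
OneRegular∧K22-free⇒candidate m G regular K22-free =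
  let d , f , l , agree = Separated⇒candidate m partnerℕ-injective partnerℕ-< (K22-free⇒Separated K22-free)
  in d , f , l , ≡graphOf (candidate d f l m) agree
  where open Partner G regular

-- Reversals, transposition and the corner count

lookup-∷ʳ-last : ∀ {A : Set} {n} (ys : Vec A n) x → lookup (ys ∷ʳ x) (fromℕ n) ≡ x
lookup-∷ʳ-last [] x = refl
lookup-∷ʳ-last (y ∷ ys) x = lookup-∷ʳ-last ys x

lookup-∷ʳ-inject₁ : ∀ {A : Set} {n} (ys : Vec A n) x i → lookup (ys ∷ʳ x) (inject₁ i) ≡ lookup ys i
lookup-∷ʳ-inject₁ (y ∷ ys) x zero = refl
lookup-∷ʳ-inject₁ (y ∷ ys) x (suc i) = lookup-∷ʳ-inject₁ ys x i

lookup-reverse-opposite : ∀ {A : Set} {n} (xs : Vec A n) i → lookup (reverse xs) (opposite i) ≡ lookup xs i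
lookup-reverse-opposite (x ∷ xs) zero = trans (cong (λ ys → lookup ys (opposite zero)) (reverse-∷ x xs))
  (lookup-∷ʳ-last (reverse xs) x)
lookup-reverse-opposite (x ∷ xs) (suc i) = trans (cong (λ ys → lookup ys (opposite (suc i))) (reverse-∷ x xs))
  (trans (lookup-∷ʳ-inject₁ (reverse xs) x (opposite i)) (lookup-reverse-opposite xs i))

lookup-reverse : ∀ {A : Set} {n} (xs : Vec A n) i → lookup (reverse xs) i ≡ lookup xs (opposite i)
lookup-reverse xs i = trans (cong (lookup (reverse xs)) (sym (opposite-involutive i)))
  (lookup-reverse-opposite xs (opposite i))

lookup-transpose-∷ : ∀ {A : Set} {p q} (as : Vec A q) (ass : Vec (Vec A q) p) j →
  lookup (transpose (as ∷ ass)) j ≡ lookup as j ∷ lookup (transpose ass) j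
lookup-transpose-∷ {A} {p} {q} as ass j = begin
  lookup (replicate q _∷_ ⊛ as ⊛ transpose ass) j
    ≡⟨ lookup-⊛ j (replicate q _∷_ ⊛ as) (transpose ass) ⟩
  lookup (replicate q _∷_ ⊛ as) j (lookup (transpose ass) j)
    ≡⟨ cong (λ f → f (lookup (transpose ass) j)) (lookup-⊛ j (replicate q _∷_) as) ⟩
  lookup (replicate q (_∷_ {A = A} {n = p})) j (lookup as j) (lookup (transpose ass) j)
    ≡⟨ cong (λ f → f (lookup as j) (lookup (transpose ass) j)) (lookup-replicate j _∷_) ⟩
  lookup as j ∷ lookup (transpose ass) j ∎
  where open ≡-Reasoning

adj-transpose : ∀ {p q} (M : Mat p q) i j → adj (transpose M) j i ≡ adj M i j
adj-transpose (as ∷ ass) zero j = cong (λ col → lookup col zero) (lookup-transpose-∷ as ass j)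
adj-transpose (as ∷ ass) (suc i) j =
  trans (cong (λ col → lookup col (suc i)) (lookup-transpose-∷ as ass j)) (adj-transpose ass i j)

oppositeIf : ∀ {n} → Bool → Fin n → Fin n
oppositeIf false i = i
oppositeIf true i = opposite i

toℕ-oppositeIf : ∀ m b (i : Fin (4 + m)) → toℕ (oppositeIf b i) ≡ flipIf b m (toℕ i)
toℕ-oppositeIf m false i = refl
toℕ-oppositeIf m true i = opposite-prop i

adj-revAIf : ∀ {p q} a (M : Mat p q) i j → adj (revAIf a M) i j ≡ adj M (oppositeIf a i) j
adj-revAIf false M i j = refl
adj-revAIf true M i j = cong (λ row → lookup row j) (lookup-reverse M i)

adj-revBIf : ∀ {p q} b (M : Mat p q) i j → adj (revBIf b M) i j ≡ adj M i (oppositeIf b j)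
adj-revBIf false M i j = refl
adj-revBIf true M i j = trans (cong (λ row → lookup row j) (lookup-map i reverse M)) (lookup-reverse (lookup M i) j)

Iso-refl : ∀ {p q} (G : Mat p q) → Iso G G
Iso-refl {p} {q} G = inj₁ (OrdIso-refl p , OrdIso-refl q , λ _ _ → refl)

graphOf-reversed : ∀ m a b (τ τ' : ℕ → ℕ) → (∀ x → x < 4 + m → τ x < 4 + m) →
  (∀ x → x < 4 + m → τ' x ≡ flipIf b m (τ (flipIf a m x))) →
  graphOf τ' ≡ revBIf b (revAIf a (graphOf {4 + m} τ))
graphOf-reversed m a b τ τ' τ<n τ'≡ = Mat-ext λ i j → Bool-ext (mk⇔
  (λ e → Equivalence.from (reversed-edge i j) (flip-side (trans (Equivalence.to (graphOf-edge τ' i j) e) (τ'≡ _ (toℕ<n i)))))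
  (λ e → Equivalence.from (graphOf-edge τ' i j)
    (trans (unflip-side (Equivalence.to (reversed-edge i j) e)) (sym (τ'≡ _ (toℕ<n i))))))
  where
  τa<n : ∀ (i : Fin (4 + m)) → τ (flipIf a m (toℕ i)) < 4 + m
  τa<n i = τ<n _ (flipIf-< a m _ (toℕ<n i))

  reversed-edge : ∀ i j → adj (revBIf b (revAIf a (graphOf τ))) i j ≡ true ⇔ flipIf b m (toℕ j) ≡ τ (flipIf a m (toℕ i))
  reversed-edge i j = subst₂ (λ u v → u ≡ true ⇔ v)
    (sym (trans (adj-revBIf b _ i j) (adj-revAIf a _ i (oppositeIf b j))))
    (cong₂ (λ x y → x ≡ τ y) (toℕ-oppositeIf m b j) (toℕ-oppositeIf m a i))
    (graphOf-edge τ (oppositeIf a i) (oppositeIf b j))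

  flip-side : ∀ {i j} → toℕ j ≡ flipIf b m (τ (flipIf a m (toℕ i))) → flipIf b m (toℕ j) ≡ τ (flipIf a m (toℕ i))
  flip-side {i} e = trans (cong (flipIf b m) e) (flipIf-involutive b m _ (τa<n i))

  unflip-side : ∀ {i} {j : Fin (4 + m)} → flipIf b m (toℕ j) ≡ τ (flipIf a m (toℕ i)) →
    toℕ j ≡ flipIf b m (τ (flipIf a m (toℕ i)))
  unflip-side {j = j} e = trans (sym (flipIf-involutive b m _ (toℕ<n j))) (cong (flipIf b m) e)

OrdIso-fixes-zero : ∀ {n} (f : OrdIso (suc n) (suc n)) → OrdIso.to f zero ≡ zero
OrdIso-fixes-zero f with OrdIso.from f zero in from0
... | zero = trans (cong (OrdIso.to f) (sym from0)) (OrdIso.to-from f zero)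
... | suc k = ⊥-elim (n≮0 (subst (λ y → toℕ (OrdIso.to f zero) < toℕ y) to-from0 (OrdIso.mono f zero (suc k) z<s)))
  where
  to-from0 : OrdIso.to f (suc k) ≡ zero
  to-from0 = trans (cong (OrdIso.to f) (sym from0)) (OrdIso.to-from f zero)

OrdIso-fixes-last : ∀ {n} (f : OrdIso (suc n) (suc n)) → OrdIso.to f (fromℕ n) ≡ fromℕ n
OrdIso-fixes-last {n} f with toℕ (OrdIso.from f (fromℕ n)) ≟ n
... | yes from-last≡n = trans (cong (OrdIso.to f) (sym (toℕ-injective (trans from-last≡n (sym (toℕ-fromℕ n))))))
  (OrdIso.to-from f (fromℕ n))
... | no from-last≢n = ⊥-elim (<-irrefl refl (<-≤-trans last<to-last (≤-pred (toℕ<n (OrdIso.to f (fromℕ n))))))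
  where
  last<to-last : n < toℕ (OrdIso.to f (fromℕ n))
  last<to-last = subst (_< toℕ (OrdIso.to f (fromℕ n))) (trans (cong toℕ (OrdIso.to-from f (fromℕ n))) (toℕ-fromℕ n))
    (OrdIso.mono f _ (fromℕ n) (subst (toℕ (OrdIso.from f (fromℕ n)) <_) (sym (toℕ-fromℕ n))
      (≤∧≢⇒< (≤-pred (toℕ<n (OrdIso.from f (fromℕ n)))) from-last≢n)))

indicator : Bool → ℕ
indicator true = 1
indicator false = 0

sum4 : Bool → Bool → Bool → Bool → ℕ
sum4 a b c d = (indicator a + indicator b) + (indicator c + indicator d)

sum4-cong : ∀ {a b c d a' b' c' d'} → a ≡ a' → b ≡ b' → c ≡ c' → d ≡ d' → sum4 a b c d ≡ sum4 a' b' c' d'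
sum4-cong refl refl refl refl = refl

sum4-transpose : ∀ a b c d → sum4 a b c d ≡ sum4 a c b d
sum4-transpose a b c d = interchange (indicator a) (indicator b) (indicator c) (indicator d)

Extreme : ∀ {n} → Fin (suc n) → Set
Extreme {n} i = i ≡ zero ⊎ i ≡ fromℕ n

zero-Extreme : ∀ {n} → Extreme {n} zero
zero-Extreme = inj₁ refl

last-Extreme : ∀ {n} → Extreme (fromℕ n)
last-Extreme = inj₂ refl

OrdIso-fixes-Extreme : ∀ {n} (f : OrdIso (suc n) (suc n)) {i} → Extreme i → OrdIso.to f i ≡ i
OrdIso-fixes-Extreme f (inj₁ refl) = OrdIso-fixes-zero f
OrdIso-fixes-Extreme f (inj₂ refl) = OrdIso-fixes-last f

corners : ∀ {n} → Mat (suc n) (suc n) → ℕ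
corners {n} M = sum4 (adj M zero zero) (adj M zero (fromℕ n)) (adj M (fromℕ n) zero) (adj M (fromℕ n) (fromℕ n))

corners-Iso : ∀ {n} {G H : Mat (suc n) (suc n)} → Iso G H → corners G ≡ corners H
corners-Iso {n} {G} {H} (inj₁ (f , g , adj≡)) =
  sum4-cong (fixed zero-Extreme zero-Extreme) (fixed zero-Extreme last-Extreme)
    (fixed last-Extreme zero-Extreme) (fixed last-Extreme last-Extreme)
  where
  fixed : ∀ {i j} → Extreme i → Extreme j → adj G i j ≡ adj H i j
  fixed ei ej = trans (adj≡ _ _) (cong₂ (adj H) (OrdIso-fixes-Extreme f ei) (OrdIso-fixes-Extreme g ej))
corners-Iso {n} {G} {H} (inj₂ (f , g , adj≡)) = trans
  (sum4-cong (fixed zero-Extreme zero-Extreme) (fixed zero-Extreme last-Extreme)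
    (fixed last-Extreme zero-Extreme) (fixed last-Extreme last-Extreme))
  (sum4-transpose (adj H zero zero) (adj H (fromℕ n) zero) (adj H zero (fromℕ n)) (adj H (fromℕ n) (fromℕ n)))
  where
  fixed : ∀ {i j} → Extreme i → Extreme j → adj G i j ≡ adj H j i
  fixed ei ej = trans (adj≡ _ _) (cong₂ (adj H) (OrdIso-fixes-Extreme g ej) (OrdIso-fixes-Extreme f ei))

opposite-last : ∀ n → opposite (fromℕ n) ≡ zero
opposite-last n = opposite-involutive zero

corners-revAIf : ∀ {n} a (M : Mat (suc n) (suc n)) → corners (revAIf a M) ≡ corners M
corners-revAIf false M = refl
corners-revAIf {n} true M = trans
  (sum4-cong (adj-revAIf true M zero zero) (adj-revAIf true M zero (fromℕ n))
    (trans (adj-revAIf true M (fromℕ n) zero) (cong (λ i → adj M i zero) (opposite-last n)))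
    (trans (adj-revAIf true M (fromℕ n) (fromℕ n)) (cong (λ i → adj M i (fromℕ n)) (opposite-last n))))
  (+-comm (indicator (adj M (fromℕ n) zero) + indicator (adj M (fromℕ n) (fromℕ n))) _)

corners-revBIf : ∀ {n} b (M : Mat (suc n) (suc n)) → corners (revBIf b M) ≡ corners M
corners-revBIf {n} false M = refl
corners-revBIf {n} true M = trans
  (sum4-cong (adj-revBIf true M zero zero)
    (trans (adj-revBIf true M zero (fromℕ n)) (cong (adj M zero) (opposite-last n)))
    (adj-revBIf true M (fromℕ n) zero)
    (trans (adj-revBIf true M (fromℕ n) (fromℕ n)) (cong (adj M (fromℕ n)) (opposite-last n))))
  (cong₂ _+_ (+-comm (indicator (adj M zero (fromℕ n))) _) (+-comm (indicator (adj M (fromℕ n) (fromℕ n))) _))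

corners-transpose : ∀ {n} (M : Mat (suc n) (suc n)) → corners (transpose M) ≡ corners M
corners-transpose {n} M = trans
  (sum4-cong (adj-transpose M zero zero) (adj-transpose M (fromℕ n) zero)
    (adj-transpose M zero (fromℕ n)) (adj-transpose M (fromℕ n) (fromℕ n)))
  (sum4-transpose (adj M zero zero) (adj M (fromℕ n) zero) (adj M zero (fromℕ n)) (adj M (fromℕ n) (fromℕ n)))

corners-Equivalent : ∀ {n} (G G' : Mat (suc n) (suc n)) → Equivalent G G' → corners G' ≡ corners G
corners-Equivalent G G' (a , b , inj₁ iso) =
  trans (corners-Iso {G = G'} {H = revBIf b (revAIf a G)} iso) (trans (corners-revBIf b (revAIf a G)) (corners-revAIf a G))
corners-Equivalent G G' (a , b , inj₂ iso) =
  trans (corners-Iso {G = G'} {H = transpose (revBIf b (revAIf a G))} iso)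
    (trans (corners-transpose (revBIf b (revAIf a G))) (trans (corners-revBIf b (revAIf a G)) (corners-revAIf a G)))

-- The three equivalence classes

almostId-flip : ∀ f l m x → x < 4 + m → almostId f l m (flip m x) ≡ flip m (almostId l f m x)
almostId-flip f l m x x<n with position m x<n
... | first = trans (almostId-last f l m) (trans (swapIf-last l m) (cong (flip m) (sym (almostId-first l f m))))
... | second = trans (almostId-penultimate f l m)
  (trans (swapIf-penultimate l m) (cong (flip m) (sym (almostId-second l f m))))
... | middle {k} k<m = begin
  almostId f l m (flip m (2 + k))   ≡⟨ cong (almostId f l m) (flip-middle m k k<m) ⟩
  almostId f l m (2 + (m ∸ suc k))  ≡⟨ almostId-middle f l m (∸-monoʳ-< z<s k<m) ⟩
  2 + (m ∸ suc k)                   ≡⟨ flip-middle m k k<m ⟨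
  flip m (2 + k)                    ≡⟨ cong (flip m) (almostId-middle l f m k<m) ⟨
  flip m (almostId l f m (2 + k))   ∎
  where open ≡-Reasoning
... | penultimate = begin
  almostId f l m (flip m (2 + m))        ≡⟨ cong (almostId f l m) (flip-penultimate m) ⟩
  almostId f l m 1                       ≡⟨ almostId-second f l m ⟩
  swapIf f 0 1                           ≡⟨ flip-involutive m _ (<-≤-trans (swapIf-0-<2 f 1 (s<s z<s)) (s≤s (s≤s z≤n))) ⟨
  flip m (flip m (swapIf f 0 1))         ≡⟨ cong (flip m) (trans (almostId-penultimate l f m) (swapIf-penultimate f m)) ⟨
  flip m (almostId l f m (2 + m))        ∎
  where open ≡-Reasoning
... | last = begin
  almostId f l m (flip m (3 + m))        ≡⟨ cong (almostId f l m) (flip-last m) ⟩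
  almostId f l m 0                       ≡⟨ almostId-first f l m ⟩
  swapIf f 0 0                           ≡⟨ flip-involutive m _ (<-≤-trans (swapIf-0-<2 f 0 z<s) (s≤s (s≤s z≤n))) ⟨
  flip m (flip m (swapIf f 0 0))         ≡⟨ cong (flip m) (trans (almostId-last l f m) (swapIf-last f m)) ⟨
  flip m (almostId l f m (3 + m))        ∎
  where open ≡-Reasoning

graphOf-injective : ∀ {n} (τ τ' : ℕ → ℕ) → graphOf {n} τ ≡ graphOf τ' → ∀ x → x < n → τ x < n → τ x ≡ τ' x
graphOf-injective {n} τ τ' graph≡ x x<n τx<n = begin
  τ x                      ≡⟨ toℕ-fromℕ< τx<n ⟨
  toℕ (fromℕ< τx<n)        ≡⟨ Equivalence.to (graphOf-edge τ' _ _) (subst (λ G → adj G _ _ ≡ true) graph≡ edge) ⟩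
  τ' (toℕ (fromℕ< x<n))    ≡⟨ cong τ' (toℕ-fromℕ< x<n) ⟩
  τ' x                     ∎
  where
  open ≡-Reasoning
  edge : adj (graphOf τ) (fromℕ< x<n) (fromℕ< τx<n) ≡ true
  edge = Equivalence.from (graphOf-edge τ _ _) (trans (toℕ-fromℕ< τx<n) (cong τ (sym (toℕ-fromℕ< x<n))))

Code : Set
Code = Bool × Bool × Bool

candidateOf : Code → ℕ → ℕ → ℕ
candidateOf (d , f , l) = candidate d f l

candidate-first : ∀ d f l m → candidate d f l m 0 ≡ flipIf d m (swapIf f 0 0)
candidate-first d f l m = cong (flipIf d m) (almostId-first f l m)

candidate-last : ∀ d f l m → candidate d f l m (3 + m) ≡ flipIf d m (flip m (swapIf l 0 0))
candidate-last d f l m = cong (flipIf d m) (trans (almostId-last f l m) (swapIf-last l m))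

-- The image of the first vertex determines d and f; given d, that of the last vertex determines l.
candidate-injective : ∀ m d f l d' f' l' → (∀ x → x < 4 + m → candidate d f l m x ≡ candidate d' f' l' m x) →
  (d , f , l) ≡ (d' , f' , l')
candidate-injective m d f l d' f' l' agree
  with flipIf-low-injective d d' m (swapIf-0-<2 f 0 z<s) (swapIf-0-<2 f' 0 z<s)
         (trans (sym (candidate-first d f l m)) (trans (agree 0 z<s) (candidate-first d' f' l' m)))
... | refl = cong₂ (λ f l → d , f , l) f≡f' l≡l'
  where
  low<n : ∀ b x → x < 2 → swapIf b 0 x < 4 + m
  low<n b x x<2 = <-≤-trans (swapIf-0-<2 b x x<2) (s≤s (s≤s z≤n))
  f≡f' : f ≡ f'
  f≡f' = swapIf-0-injective f f' (flipIf-injective d m (low<n f 0 z<s) (low<n f' 0 z<s)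
    (trans (sym (candidate-first d f l m)) (trans (agree 0 z<s) (candidate-first d f' l' m))))
  l≡l' : l ≡ l'
  l≡l' = swapIf-0-injective l l' (flipIf-injective true m (low<n l 0 z<s) (low<n l' 0 z<s)
    (flipIf-injective d m (flip-< m (swapIf l 0 0)) (flip-< m (swapIf l' 0 0))
      (trans (sym (candidate-last d f l m)) (trans (agree (3 + m) ≤-refl) (candidate-last d f' l' m)))))

graphOf-candidate-injective : ∀ m c c' → graphOf {4 + m} (candidateOf c m) ≡ graphOf (candidateOf c' m) → c ≡ c'
graphOf-candidate-injective m (d , f , l) (d' , f' , l') graph≡ = candidate-injective m d f l d' f' l'
  λ x x<n → graphOf-injective (candidate d f l m) (candidate d' f' l' m) graph≡ x x<n (candidate-< d f l m x x<n)

decode : Fin 8 → Code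
decode zero = false , false , false
decode (suc zero) = false , false , true
decode (suc (suc zero)) = false , true , false
decode (suc (suc (suc zero))) = false , true , true
decode (suc (suc (suc (suc zero)))) = true , false , false
decode (suc (suc (suc (suc (suc zero))))) = true , false , true
decode (suc (suc (suc (suc (suc (suc zero)))))) = true , true , false
decode (suc (suc (suc (suc (suc (suc (suc zero))))))) = true , true , true

encode : Code → Fin 8
encode (false , false , false) = zero
encode (false , false , true) = suc zero
encode (false , true , false) = suc (suc zero)
encode (false , true , true) = suc (suc (suc zero))
encode (true , false , false) = suc (suc (suc (suc zero)))
encode (true , false , true) = suc (suc (suc (suc (suc zero))))
encode (true , true , false) = suc (suc (suc (suc (suc (suc zero)))))
encode (true , true , true) = suc (suc (suc (suc (suc (suc (suc zero))))))

encode-decode : ∀ k → encode (decode k) ≡ k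
encode-decode zero = refl
encode-decode (suc zero) = refl
encode-decode (suc (suc zero)) = refl
encode-decode (suc (suc (suc zero))) = refl
encode-decode (suc (suc (suc (suc zero)))) = refl
encode-decode (suc (suc (suc (suc (suc zero))))) = refl
encode-decode (suc (suc (suc (suc (suc (suc zero)))))) = refl
encode-decode (suc (suc (suc (suc (suc (suc (suc zero))))))) = refl

decode-encode : ∀ c → decode (encode c) ≡ c
decode-encode (false , false , false) = refl
decode-encode (false , false , true) = refl
decode-encode (false , true , false) = refl
decode-encode (false , true , true) = refl
decode-encode (true , false , false) = refl
decode-encode (true , false , true) = refl
decode-encode (true , true , false) = refl
decode-encode (true , true , true) = refl

matching : ∀ m → Fin 8 → Mat (4 + m) (4 + m)
matching m k = graphOf (candidateOf (decode k) m)

matching-injective : ∀ m k k' → matching m k ≡ matching m k' → k ≡ k'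
matching-injective m k k' matching≡ =
  trans (sym (encode-decode k)) (trans (cong encode (graphOf-candidate-injective m _ _ matching≡)) (encode-decode k'))

matching-characterisation : ∀ m (G : Mat (4 + m) (4 + m)) →
  (Σ (Fin 8) λ k → matching m k ≡ G) ⇔ (OneRegular G × ¬ (K22 ≼ G))
matching-characterisation m G = mk⇔ to from
  where
  to : (Σ (Fin 8) λ k → matching m k ≡ G) → OneRegular G × ¬ (K22 ≼ G)
  to (k , refl) with decode k
  ... | d , f , l = candidate-oneRegular d f l m , candidate-K22-free d f l m
  from : OneRegular G × ¬ (K22 ≼ G) → Σ (Fin 8) λ k → matching m k ≡ G
  from (regular , K22-free) =
    let d , f , l , G≡ = OneRegular∧K22-free⇒candidate m G regular K22-free
    in encode (d , f , l) , trans (cong (λ c → graphOf (candidateOf c m)) (decode-encode (d , f , l))) (sym G≡)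

representative : Fin 3 → Fin 8
representative zero = encode (false , false , false)
representative (suc zero) = encode (false , true , false)
representative (suc (suc zero)) = encode (false , true , true)

corners-graphOf : ∀ m (τ : ℕ → ℕ) →
  corners (graphOf {4 + m} τ) ≡ sum4 (0 ≡ᵇ τ 0) (3 + m ≡ᵇ τ 0) (0 ≡ᵇ τ (3 + m)) (3 + m ≡ᵇ τ (3 + m))
corners-graphOf m τ = sum4-cong (adj-graphOf τ (zero {3 + m}) zero)
  (trans (adj-graphOf τ zero (fromℕ (3 + m))) (cong (_≡ᵇ τ 0) (toℕ-fromℕ (3 + m))))
  (trans (adj-graphOf τ (fromℕ (3 + m)) zero) (cong (λ x → 0 ≡ᵇ τ x) (toℕ-fromℕ (3 + m))))
  (trans (adj-graphOf τ (fromℕ (3 + m)) (fromℕ (3 + m))) (cong (λ x → x ≡ᵇ τ x) (toℕ-fromℕ (3 + m))))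

corners-representative : ∀ m c → corners (matching m (representative c)) ≡ 2 ∸ toℕ c
corners-representative m zero = trans (corners-graphOf m (candidate false false false m))
  (cong (sum4 true false false) (≡ᵇ-refl (3 + m)))
corners-representative m (suc zero) = trans (corners-graphOf m (candidate false true false m))
  (cong (sum4 false false false) (≡ᵇ-refl (3 + m)))
corners-representative m (suc (suc zero)) = trans (corners-graphOf m (candidate false true true m))
  (cong (sum4 false false false) (≡ᵇ-false (λ e → 1+n≢n (trans e (cong (2 +_) (swapAt-suc m))))))

representatives-inequivalent : ∀ m c c' →
  Equivalent (matching m (representative c)) (matching m (representative c')) → c ≡ c'
representatives-inequivalent m c c' equivalent = toℕ-injective (∸-cancelˡ-≡ (toℕ≤pred[n] c) (toℕ≤pred[n] c') (begin
  2 ∸ toℕ c                                  ≡⟨ corners-representative m c ⟨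
  corners (matching m (representative c))    ≡⟨ corners-Equivalent _ (matching m (representative c')) equivalent ⟨
  corners (matching m (representative c'))   ≡⟨ corners-representative m c' ⟩
  2 ∸ toℕ c'                                 ∎))
  where open ≡-Reasoning

Equivalent-graphOf : ∀ m a b (τ τ' : ℕ → ℕ) → (∀ x → x < 4 + m → τ x < 4 + m) →
  (∀ x → x < 4 + m → τ' x ≡ flipIf b m (τ (flipIf a m x))) → Equivalent (graphOf {4 + m} τ) (graphOf τ')
Equivalent-graphOf m a b τ τ' τ<n τ'≡ =
  a , b , inj₁ (subst (Iso (graphOf τ')) (graphOf-reversed m a b τ τ' τ<n τ'≡) (Iso-refl (graphOf τ')))

almostId-conjugate : ∀ f l m x → x < 4 + m → almostId l f m x ≡ flip m (almostId f l m (flip m x))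
almostId-conjugate f l m x x<n =
  trans (sym (flip-involutive m _ (almostId-< l f m x x<n))) (cong (flip m) (sym (almostId-flip f l m x x<n)))

almostId-unflip : ∀ f l m x → x < 4 + m → almostId f l m x ≡ flip m (flip m (almostId f l m x))
almostId-unflip f l m x x<n = sym (flip-involutive m _ (almostId-< f l m x x<n))

-- Reversing B undoes d; reversing both parts turns a swap of the last pair into one of the first pair.
representatives-cover : ∀ m k → Σ (Fin 3) λ c → Equivalent (matching m k) (matching m (representative c))
representatives-cover m k = cover (decode k)
  where
  cover : ∀ code → Σ (Fin 3) λ c → Equivalent (graphOf (candidateOf code m)) (matching m (representative c))
  cover (false , false , false) = zero , Equivalent-graphOf m false false _ _ (candidate-< false false false m) λ _ _ → refl
  cover (false , false , true) =
    suc zero , Equivalent-graphOf m true true _ _ (candidate-< false false true m) (almostId-conjugate false true m)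
  cover (false , true , false) = suc zero , Equivalent-graphOf m false false _ _ (candidate-< false true false m) λ _ _ → refl
  cover (false , true , true) = suc (suc zero) , Equivalent-graphOf m false false _ _ (candidate-< false true true m) λ _ _ → refl
  cover (true , false , false) =
    zero , Equivalent-graphOf m false true _ _ (candidate-< true false false m) (almostId-unflip false false m)
  cover (true , false , true) =
    suc zero , Equivalent-graphOf m true false _ _ (candidate-< true false true m) (almostId-conjugate false true m)
  cover (true , true , false) =
    suc zero , Equivalent-graphOf m false true _ _ (candidate-< true true false m) (almostId-unflip true false m)
  cover (true , true , true) =
    suc (suc zero) , Equivalent-graphOf m false true _ _ (candidate-< true true true m) (almostId-unflip true true m)

corollary3p3 : (n : ℕ) → 4 ≤ n →
  Σ (Fin 8 → Mat n n) λ L →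
    (∀ k l → L k ≡ L l → k ≡ l) ×
    (∀ (G : Mat n n) → (Σ (Fin 8) λ k → L k ≡ G) ⇔ (OneRegular G × ¬ (K22 ≼ G))) ×
    (Σ (Fin 3 → Fin 8) λ R →
      (∀ k l → Equivalent (L (R k)) (L (R l)) → k ≡ l) ×
      (∀ k → Σ (Fin 3) λ c → Equivalent (L k) (L (R c))))
corollary3p3 (suc (suc (suc (suc m)))) (s≤s (s≤s (s≤s (s≤s _)))) =
  matching m , matching-injective m , matching-characterisation m ,
  representative , representatives-inequivalent m , representatives-cover m
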